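{- Let $m\ge1$ and $N\in\Gamma_m$, and write $\gamma(N)=c_L\dots c_0\cdot c_{ -1}\dots c_R$ with $c_L=c_R=1$. If $m=2n$ then $L=2n=-R$; if $m=2n+1$ then $L=2n+1$ and $-R=2n+2$. Equivalently, for $N\ge2$: $L(N)=2n=-R(N)$ iff $N\in\Gamma_{2n}$, and $L(N)=2n+1,\ -R(N)=2n+2$ iff $N\in\Gamma_{2n+1}$; in particular the canonical Lucas intervals $\Gamma_m$, $m\ge1$, are exactly the intervals of constant expansion length of the canonical representation.
   Context: Let $\varphi=(1+\sqrt5)/2$. Lucas numbers: $L_0=2$, $L_1=1$, $L_n=L_{n-1}+L_{n-2}$. Canonical Lucas intervals: $\Gamma_0=\{1\}$ and $\Gamma_n=[L_n+1,L_{n+1}]\cap\mathbb Z$ for $n\ge1$ (so $\Gamma_1=\{2,3\}$, $\Gamma_2=\{4\}$, $\Gamma_3=\{5,6,7\}$, \dots). The Bergman representation $\beta(N)$ is the unique finite expansion $N=\sum_i d_i\varphi^i$ with digits in $\{0,1\}$ and no two consecutive digits $11$. The canonical representation $\gamma(N)=c_L\dots c_0\cdot c_{ -1}\dots c_R$: if $N$ has a finite representation with digits in $\{0,1\}$, $c_1=c_0=1$, and $c_{i+1}c_i\ne11$ for all $i\ne0$, then $\gamma(N)$ is this (unique) representation; otherwise $\gamma(N)=\beta(N)$. Here $L=L(N)$ is the largest and $R=R(N)$ the smallest index of a nonzero digit. -}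

module Defs where

open import Data.Nat using (ℕ; zero; suc; _≤_)
open import Data.Integer using (ℤ; +_; -[1+_]; _+_; _-_; -_)
open import Data.Bool using (Bool; true; false)
open import Data.List using (List; []; _∷_; length)
open import Data.Product using (Σ; _×_)
open import Data.Sum using (_⊎_)
open import Relation.Nullary using (¬_)
open import Relation.Binary.PropositionalEquality using (_≡_; _≢_)

lucas : ℕ → ℕ
lucas zero = 2
lucas (suc zero) = 1
lucas (suc (suc n)) = lucas (suc n) Data.Nat.+ lucas n

InΓ : ℕ → ℕ → Set
InΓ zero N = N ≡ 1
InΓ (suc m) N = (suc (lucas (suc m)) ≤ N) × (N ≤ lucas (suc (suc m)))

-- The ring ℤ[φ]; ⟨ a , b ⟩ stands for a + bφ, with φ² = φ + 1.
-- Every element has a unique such form, so propositional equality is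
-- equality of the corresponding real numbers.
record ℤφ : Set where
  constructor ⟨_,_⟩
  field
    re : ℤ
    im : ℤ
open ℤφ public

_⊕_ : ℤφ → ℤφ → ℤφ
⟨ a , b ⟩ ⊕ ⟨ c , d ⟩ = ⟨ a + c , b + d ⟩

zeroφ : ℤφ
zeroφ = ⟨ + 0 , + 0 ⟩

oneφ : ℤφ
oneφ = ⟨ + 1 , + 0 ⟩

-- multiplication by φ:  (a + bφ)φ = b + (a + b)φ
timesφ : ℤφ → ℤφ
timesφ ⟨ a , b ⟩ = ⟨ b , a + b ⟩

-- multiplication by φ⁻¹ = φ - 1:  (a + bφ)(φ - 1) = (b - a) + aφ
timesφ⁻¹ : ℤφ → ℤφ
timesφ⁻¹ ⟨ a , b ⟩ = ⟨ b - a , a ⟩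

iter : ℕ → (ℤφ → ℤφ) → ℤφ → ℤφ
iter zero f x = x
iter (suc n) f x = f (iter n f x)

φ^ : ℤ → ℤφ
φ^ (+ n) = iter n timesφ oneφ
φ^ -[1+ n ] = iter (suc n) timesφ⁻¹ oneφ

ℕ→ℤφ : ℕ → ℤφ
ℕ→ℤφ n = ⟨ + n , + 0 ⟩

-- A finite {0,1}-digit string: digits d_low, d_{low+1}, …, listed from
-- the lowest position upwards (true = digit 1).
record Rep : Set where
  constructor rep
  field
    low    : ℤ
    digits : List Bool
open Rep public

valueFrom : ℤ → List Bool → ℤφ
valueFrom k [] = zeroφ
valueFrom k (true ∷ ds) = φ^ k ⊕ valueFrom (k + + 1) ds
valueFrom k (false ∷ ds) = valueFrom (k + + 1) ds

value : Rep → ℤφ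
value r = valueFrom (low r) (digits r)

lookupℕ : List Bool → ℕ → Bool
lookupℕ [] _ = false
lookupℕ (d ∷ ds) zero = d
lookupℕ (d ∷ ds) (suc n) = lookupℕ ds n

lookupℤ : List Bool → ℤ → Bool
lookupℤ ds (+ n) = lookupℕ ds n
lookupℤ ds -[1+ n ] = false

digit : Rep → ℤ → Bool
digit r i = lookupℤ (digits r) (i - low r)

Lidx : Rep → ℤ
Lidx r = low r + + (length (digits r)) - + 1

Ridx : Rep → ℤ
Ridx r = low r

-- the string is trimmed: c_L = c_R = 1, so L and R are the extreme
-- indices of nonzero digits
Proper : Rep → Set
Proper r = (digit r (Ridx r) ≡ true) × (digit r (Lidx r) ≡ true)

IsBergman : ℕ → Rep → Set
IsBergman N r =
  Proper r × (value r ≡ ℕ→ℤφ N) ×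
  (∀ (i : ℤ) → ¬ ((digit r (i + + 1) ≡ true) × (digit r i ≡ true)))

IsSpecial : ℕ → Rep → Set
IsSpecial N r =
  Proper r × (value r ≡ ℕ→ℤφ N) ×
  (digit r (+ 1) ≡ true) × (digit r (+ 0) ≡ true) ×
  (∀ (i : ℤ) → i ≢ + 0 → ¬ ((digit r (i + + 1) ≡ true) × (digit r i ≡ true)))

IsCanonical : ℕ → Rep → Set
IsCanonical N r = IsSpecial N r ⊎ ((¬ Σ Rep (IsSpecial N)) × IsBergman N r)

-- Positivity in ℤ[φ] is decided by multiplying with a large power of φ, and a digit string without 11
-- whose digits lie below position k has value < φᵏ; hence Bergman representations are unique, and so are
-- special ones once their digits at 1 and 0 are removed. Carrying the 11 of a special representation
-- produces a Bergman representation of a recognisable shape, so a Bergman representation without that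
-- shape excludes special ones.
-- For N ∈ Γₘ with m ≥ 2 write N = Lₘ + k, k in a lower interval Γ_M. Since Lₘ = φᵐ + (−φ)⁻ᵐ, the canonical
-- expansion of N is that of k with 1s added at ±m (m even), resp. with 1s added at m and −(m+1) and the
-- lowest digit −2⌈M/2⌉ of k replaced by 1s at the odd positions between it and −m (m odd). Induction gives
-- L = m and R = −2⌈m/2⌉, and by uniqueness every canonical representation of N has these digits.

module Submission where

open import Defs

open import Data.Bool using (Bool; true; false; _∨_; _∧_; not)
open import Data.Bool.Properties using (∨-zeroʳ; ∨-identityʳ; ∧-zeroʳ; ∧-identityʳ)
open import Data.Empty using (⊥; ⊥-elim)
open import Data.Integer as ℤ using (ℤ; +_; -_; -[1+_]; _+_; _-_)
import Data.Integer.Properties as ℤ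
open import Data.Integer.Tactic.RingSolver using (solve-∀)
open import Data.List using (List; []; _∷_; applyUpTo; length)
open import Data.List.Properties using (length-applyUpTo)
open import Data.Nat as ℕ using (ℕ; zero; suc; _≤_; _<_; _*_; ⌈_/2⌉; ⌊_/2⌋)
import Data.Nat.Properties as ℕ
import Data.Nat.Tactic.RingSolver as ℕ-Solver
open import Data.Product using (Σ; _×_; _,_; proj₁; proj₂; swap)
open import Data.Sum using (_⊎_; inj₁; inj₂; [_,_]′)
open import Function using (_∘_)
open import Function.Bundles using (_⇔_; mk⇔)
open import Relation.Binary.Definitions using (tri<; tri≈; tri>)
open import Relation.Binary.PropositionalEquality
  using (_≡_; _≢_; refl; sym; trans; cong; cong₂; subst; subst₂; module ≡-Reasoning)
open import Relation.Nullary using (¬_; Dec; yes; no)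
open import Relation.Nullary.Decidable using (⌊_⌋)

open import Algebra.Properties.AbelianGroup ℤ.+-0-abelianGroup using ()
  renaming (∙-cancelˡ to +-cancelˡ; ∙-cancelʳ to +-cancelʳ)

+-sucʳ : ∀ a j → a + + suc j ≡ (a + + j) + + 1
+-sucʳ a j = trans (cong (λ z → a + + z) (ℕ.+-comm 1 j)) (sym (ℤ.+-assoc a (+ j) (+ 1)))

+ℕ-cancelˡ : ∀ a {j k} → a + + j ≡ a + + k → j ≡ k
+ℕ-cancelˡ a eq = ℤ.+-injective (+-cancelˡ a _ _ eq)

i+1≢i : ∀ i → i + + 1 ≢ i
i+1≢i i eq = ℕ.1+n≢0 (+ℕ-cancelˡ i (trans eq (sym (ℤ.+-identityʳ i))))

[a+j]-a≡j : ∀ a j → (a + j) - a ≡ j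
[a+j]-a≡j = solve-∀

i≡a+[i-a] : ∀ a i → i ≡ a + (i - a)
i≡a+[i-a] = solve-∀

neg : ℤφ → ℤφ
neg ⟨ a , b ⟩ = ⟨ - a , - b ⟩

_⊖_ : ℤφ → ℤφ → ℤφ
x ⊖ y = x ⊕ neg y

⊕-comm : ∀ x y → x ⊕ y ≡ y ⊕ x
⊕-comm ⟨ a , b ⟩ ⟨ c , d ⟩ = cong₂ ⟨_,_⟩ (ℤ.+-comm a c) (ℤ.+-comm b d)

⊕-assoc : ∀ x y z → (x ⊕ y) ⊕ z ≡ x ⊕ (y ⊕ z)
⊕-assoc ⟨ a , b ⟩ ⟨ c , d ⟩ ⟨ e , f ⟩ = cong₂ ⟨_,_⟩ (ℤ.+-assoc a c e) (ℤ.+-assoc b d f)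

⊕-identityˡ : ∀ x → zeroφ ⊕ x ≡ x
⊕-identityˡ ⟨ a , b ⟩ = cong₂ ⟨_,_⟩ (ℤ.+-identityˡ a) (ℤ.+-identityˡ b)

⊕-identityʳ : ∀ x → x ⊕ zeroφ ≡ x
⊕-identityʳ ⟨ a , b ⟩ = cong₂ ⟨_,_⟩ (ℤ.+-identityʳ a) (ℤ.+-identityʳ b)

⊖-self : ∀ x → x ⊖ x ≡ zeroφ
⊖-self ⟨ a , b ⟩ = cong₂ ⟨_,_⟩ (ℤ.+-inverseʳ a) (ℤ.+-inverseʳ b)

neg-involutive : ∀ x → neg (neg x) ≡ x
neg-involutive ⟨ a , b ⟩ = cong₂ ⟨_,_⟩ (ℤ.neg-involutive a) (ℤ.neg-involutive b)

⊕-cancelʳ : ∀ x y z → x ⊕ z ≡ y ⊕ z → x ≡ y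
⊕-cancelʳ ⟨ a , b ⟩ ⟨ c , d ⟩ ⟨ e , f ⟩ eq =
  cong₂ ⟨_,_⟩ (+-cancelʳ e a c (cong re eq)) (+-cancelʳ f b d (cong im eq))

⊕≡0⇒≡neg : ∀ x y → x ⊕ y ≡ zeroφ → y ≡ neg x
⊕≡0⇒≡neg x y eq = ⊕-cancelʳ y (neg x) x
  (trans (⊕-comm y x) (trans eq (sym (trans (⊕-comm (neg x) x) (⊖-self x)))))

timesφ-⊕ : ∀ x y → timesφ (x ⊕ y) ≡ timesφ x ⊕ timesφ y
timesφ-⊕ ⟨ a , b ⟩ ⟨ c , d ⟩ = cong ⟨ b + d ,_⟩ (+-interchange a c b d)
  where
  +-interchange : ∀ a c b d → (a + c) + (b + d) ≡ (a + b) + (c + d)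
  +-interchange = solve-∀

timesφ-neg : ∀ x → timesφ (neg x) ≡ neg (timesφ x)
timesφ-neg ⟨ a , b ⟩ = cong ⟨ - b ,_⟩ (sym (ℤ.neg-distrib-+ a b))

timesφ-timesφ⁻¹ : ∀ x → timesφ (timesφ⁻¹ x) ≡ x
timesφ-timesφ⁻¹ ⟨ a , b ⟩ = cong ⟨ a ,_⟩ (b-a+a≡b a b)
  where
  b-a+a≡b : ∀ a b → (b - a) + a ≡ b
  b-a+a≡b = solve-∀

timesφ-timesφ : ∀ x → timesφ (timesφ x) ≡ timesφ x ⊕ x
timesφ-timesφ ⟨ a , b ⟩ = cong₂ ⟨_,_⟩ (ℤ.+-comm a b) (ℤ.+-comm b (a + b))

φ^-suc : ∀ k → φ^ (k + + 1) ≡ timesφ (φ^ k)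
φ^-suc (+ n) rewrite ℕ.+-comm n 1 = refl
φ^-suc -[1+ zero ] = sym (timesφ-timesφ⁻¹ oneφ)
φ^-suc -[1+ suc n ] = sym (timesφ-timesφ⁻¹ _)

φ^-+2 : ∀ k → φ^ (k + + 2) ≡ φ^ (k + + 1) ⊕ φ^ k
φ^-+2 k = begin
  φ^ (k + + 2)                 ≡⟨ cong φ^ (sym (ℤ.+-assoc k (+ 1) (+ 1))) ⟩
  φ^ ((k + + 1) + + 1)         ≡⟨ φ^-suc (k + + 1) ⟩
  timesφ (φ^ (k + + 1))        ≡⟨ cong timesφ (φ^-suc k) ⟩
  timesφ (timesφ (φ^ k))       ≡⟨ timesφ-timesφ (φ^ k) ⟩
  timesφ (φ^ k) ⊕ φ^ k         ≡⟨ cong (_⊕ φ^ k) (sym (φ^-suc k)) ⟩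
  φ^ (k + + 1) ⊕ φ^ k          ∎
  where open ≡-Reasoning

-- A real x = a + bφ is ≥ 0 iff φᴷx has natural coordinates for some K: these coordinates are
-- approximately φᴷ⁻¹x/√5 and φᴷx/√5.
NatCoords : ℤφ → Set
NatCoords x = Σ ℕ λ p → Σ ℕ λ q → x ≡ ⟨ + p , + q ⟩

NonNeg : ℤφ → Set
NonNeg x = Σ ℕ λ K → NatCoords (iter K timesφ x)

Positive : ℤφ → Set
Positive x = NonNeg x × x ≢ zeroφ

NatCoords-timesφ : ∀ {x} → NatCoords x → NatCoords (timesφ x)
NatCoords-timesφ (p , q , refl) = q , p ℕ.+ q , refl

NatCoords-iter : ∀ j {x} → NatCoords x → NatCoords (iter j timesφ x)
NatCoords-iter zero c = c
NatCoords-iter (suc j) c = NatCoords-timesφ (NatCoords-iter j c)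

NatCoords-⊕ : ∀ {x y} → NatCoords x → NatCoords y → NatCoords (x ⊕ y)
NatCoords-⊕ (p , q , refl) (p′ , q′ , refl) = p ℕ.+ p′ , q ℕ.+ q′ , refl

NatCoords-antisym : ∀ {x} → NatCoords x → NatCoords (neg x) → x ≡ zeroφ
NatCoords-antisym (zero , zero , refl) _ = refl
NatCoords-antisym (suc p , q , refl) (_ , _ , ())
NatCoords-antisym (zero , suc q , refl) (_ , _ , ())

iter-+ : ∀ j K (f : ℤφ → ℤφ) x → iter (j ℕ.+ K) f x ≡ iter j f (iter K f x)
iter-+ zero K f x = refl
iter-+ (suc j) K f x = cong f (iter-+ j K f x)

iter-commute : ∀ {f g : ℤφ → ℤφ} → (∀ x → f (g x) ≡ g (f x)) → ∀ K x → iter K f (g x) ≡ g (iter K f x)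
iter-commute comm zero x = refl
iter-commute {f} comm (suc K) x = trans (cong f (iter-commute comm K x)) (comm _)

iter-timesφ-⊕ : ∀ K x y → iter K timesφ (x ⊕ y) ≡ iter K timesφ x ⊕ iter K timesφ y
iter-timesφ-⊕ zero x y = refl
iter-timesφ-⊕ (suc K) x y = trans (cong timesφ (iter-timesφ-⊕ K x y)) (timesφ-⊕ (iter K timesφ x) (iter K timesφ y))

iter-reflects-zero : ∀ {f : ℤφ → ℤφ} → (∀ x → f x ≡ zeroφ → x ≡ zeroφ) →
                     ∀ K x → iter K f x ≡ zeroφ → x ≡ zeroφ
iter-reflects-zero f0 zero x eq = eq
iter-reflects-zero f0 (suc K) x eq = iter-reflects-zero f0 K x (f0 _ eq)

timesφ-reflects-zero : ∀ x → timesφ x ≡ zeroφ → x ≡ zeroφ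
timesφ-reflects-zero ⟨ a , + zero ⟩ eq = cong₂ ⟨_,_⟩ (trans (sym (ℤ.+-identityʳ a)) (cong im eq)) refl
timesφ-reflects-zero ⟨ a , + suc n ⟩ ()
timesφ-reflects-zero ⟨ a , -[1+ n ] ⟩ ()

timesφ⁻¹-reflects-zero : ∀ x → timesφ⁻¹ x ≡ zeroφ → x ≡ zeroφ
timesφ⁻¹-reflects-zero x eq = trans (sym (timesφ-timesφ⁻¹ x)) (cong timesφ eq)

NatCoords-common : ∀ {x y} → NonNeg x → NonNeg y →
                   Σ ℕ λ K → NatCoords (iter K timesφ x) × NatCoords (iter K timesφ y)
NatCoords-common {x} {y} (K₁ , c₁) (K₂ , c₂) =
  K₂ ℕ.+ K₁ ,
  subst NatCoords (sym (iter-+ K₂ K₁ timesφ x)) (NatCoords-iter K₂ c₁) ,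
  subst (λ K → NatCoords (iter K timesφ y)) (ℕ.+-comm K₁ K₂)
    (subst NatCoords (sym (iter-+ K₁ K₂ timesφ y)) (NatCoords-iter K₁ c₂))

NonNeg-⊕ : ∀ {x y} → NonNeg x → NonNeg y → NonNeg (x ⊕ y)
NonNeg-⊕ {x} {y} nx ny with NatCoords-common nx ny
... | K , cx , cy = K , subst NatCoords (sym (iter-timesφ-⊕ K x y)) (NatCoords-⊕ cx cy)

NonNeg-antisym : ∀ {x} → NonNeg x → NonNeg (neg x) → x ≡ zeroφ
NonNeg-antisym {x} nx nnx with NatCoords-common nx nnx
... | K , cx , cnx = iter-reflects-zero timesφ-reflects-zero K x
  (NatCoords-antisym cx (subst NatCoords (iter-commute {timesφ} {neg} timesφ-neg K x) cnx))

NonNeg-timesφ : ∀ {x} → NonNeg x → NonNeg (timesφ x)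
NonNeg-timesφ {x} (K , c) = K , subst NatCoords (sym (iter-commute {timesφ} {timesφ} (λ _ → refl) K x)) (NatCoords-timesφ c)

NonNeg-timesφ⁻¹ : ∀ {x} → NonNeg x → NonNeg (timesφ⁻¹ x)
NonNeg-timesφ⁻¹ {x} (K , c) = suc K , subst NatCoords eq c
  where
  eq : iter K timesφ x ≡ iter (suc K) timesφ (timesφ⁻¹ x)
  eq = trans (cong (iter K timesφ) (sym (timesφ-timesφ⁻¹ x))) (iter-commute {timesφ} {timesφ} (λ _ → refl) K (timesφ⁻¹ x))

NonNeg-zero : NonNeg zeroφ
NonNeg-zero = 0 , 0 , 0 , refl

NonNeg-iter : ∀ {f} → (∀ {x} → NonNeg x → NonNeg (f x)) → ∀ n {x} → NonNeg x → NonNeg (iter n f x)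
NonNeg-iter f-pos zero nx = nx
NonNeg-iter f-pos (suc n) nx = f-pos (NonNeg-iter f-pos n nx)

NonNeg-φ^ : ∀ k → NonNeg (φ^ k)
NonNeg-φ^ (+ n) = NonNeg-iter NonNeg-timesφ n (0 , 1 , 0 , refl)
NonNeg-φ^ -[1+ n ] = NonNeg-iter NonNeg-timesφ⁻¹ (suc n) (0 , 1 , 0 , refl)

φ^≢0 : ∀ k → φ^ k ≢ zeroφ
φ^≢0 (+ n) eq with iter-reflects-zero timesφ-reflects-zero n oneφ eq
... | ()
φ^≢0 -[1+ n ] eq with iter-reflects-zero timesφ⁻¹-reflects-zero (suc n) oneφ eq
... | ()

Positive-φ^ : ∀ k → Positive (φ^ k)
Positive-φ^ k = NonNeg-φ^ k , φ^≢0 k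

NonNeg-⊕-Positive : ∀ {x y} → NonNeg x → Positive y → Positive (x ⊕ y)
NonNeg-⊕-Positive {x} {y} nx (ny , y≢0) = NonNeg-⊕ nx ny , λ x+y≡0 →
  y≢0 (NonNeg-antisym ny (subst NonNeg (sym (trans (cong neg (⊕≡0⇒≡neg x y x+y≡0)) (neg-involutive x))) nx))

NonNeg⇒¬Positive-neg : ∀ {x} → NonNeg x → ¬ Positive (neg x)
NonNeg⇒¬Positive-neg {x} nx (nnx , nx≢0) = nx≢0 (cong neg (NonNeg-antisym nx nnx))

-- A digit string maps positions to digits; its value is taken on a finite window [a, a + n) containing all its
-- 1s, and does not depend on that window (valueOn-window-independent).
Digits : Set
Digits = ℤ → Bool

InWindow : ℤ → ℕ → ℤ → Set
InWindow a n i = Σ ℕ λ j → j < n × i ≡ a + + j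

SupportedIn : Digits → ℤ → ℕ → Set
SupportedIn f a n = ∀ i → f i ≡ true → InWindow a n i

No11 : Digits → Set
No11 f = ∀ i → ¬ (f (i + + 1) ≡ true × f i ≡ true)

window : Digits → ℤ → ℕ → List Bool
window f a n = applyUpTo (λ j → f (a + + j)) n

valueOn : Digits → ℤ → ℕ → ℤφ
valueOn f a n = valueFrom a (window f a n)

digitValue : Bool → ℤ → ℤφ
digitValue true k = φ^ k
digitValue false k = zeroφ

applyUpTo-cong : ∀ n {g h : ℕ → Bool} → (∀ j → g j ≡ h j) → applyUpTo g n ≡ applyUpTo h n
applyUpTo-cong zero eq = refl
applyUpTo-cong (suc n) eq = cong₂ _∷_ (eq 0) (applyUpTo-cong n (λ j → eq (suc j)))

valueOn-cong : ∀ {f g} a n → (∀ i → f i ≡ g i) → valueOn f a n ≡ valueOn g a n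
valueOn-cong a n eq = cong (valueFrom a) (applyUpTo-cong n (λ j → eq (a + + j)))

valueFrom-∷ : ∀ a b ds → valueFrom a (b ∷ ds) ≡ digitValue b a ⊕ valueFrom (a + + 1) ds
valueFrom-∷ a true ds = refl
valueFrom-∷ a false ds = sym (⊕-identityˡ _)

valueOn-sucˡ : ∀ f a n → valueOn f a (suc n) ≡ digitValue (f a) a ⊕ valueOn f (a + + 1) n
valueOn-sucˡ f a n = begin
  valueFrom a (f (a + + 0) ∷ applyUpTo (λ j → f (a + + suc j)) n)
    ≡⟨ valueFrom-∷ a (f (a + + 0)) _ ⟩
  digitValue (f (a + + 0)) a ⊕ valueFrom (a + + 1) (applyUpTo (λ j → f (a + + suc j)) n)
    ≡⟨ cong₂ (λ i ds → digitValue (f i) a ⊕ valueFrom (a + + 1) ds) (ℤ.+-identityʳ a)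
             (applyUpTo-cong n (λ j → cong f (sym (ℤ.+-assoc a (+ 1) (+ j))))) ⟩
  digitValue (f a) a ⊕ valueOn f (a + + 1) n ∎
  where open ≡-Reasoning

valueOn-suc : ∀ f a n → valueOn f a (suc n) ≡ valueOn f a n ⊕ digitValue (f (a + + n)) (a + + n)
valueOn-suc f a zero = begin
  valueOn f a 1                      ≡⟨ valueOn-sucˡ f a 0 ⟩
  digitValue (f a) a ⊕ zeroφ         ≡⟨ ⊕-identityʳ _ ⟩
  digitValue (f a) a                 ≡⟨ cong (λ i → digitValue (f i) i) (sym (ℤ.+-identityʳ a)) ⟩
  digitValue (f (a + + 0)) (a + + 0) ≡⟨ sym (⊕-identityˡ _) ⟩
  zeroφ ⊕ digitValue (f (a + + 0)) (a + + 0) ∎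
  where open ≡-Reasoning
valueOn-suc f a (suc n) = begin
  valueOn f a (suc (suc n))
    ≡⟨ valueOn-sucˡ f a (suc n) ⟩
  digitValue (f a) a ⊕ valueOn f (a + + 1) (suc n)
    ≡⟨ cong (digitValue (f a) a ⊕_) (valueOn-suc f (a + + 1) n) ⟩
  digitValue (f a) a ⊕ (valueOn f (a + + 1) n ⊕ digitValue (f i) i)
    ≡⟨ sym (⊕-assoc (digitValue (f a) a) (valueOn f (a + + 1) n) (digitValue (f i) i)) ⟩
  (digitValue (f a) a ⊕ valueOn f (a + + 1) n) ⊕ digitValue (f i) i
    ≡⟨ cong₂ _⊕_ (sym (valueOn-sucˡ f a n)) (cong (λ i → digitValue (f i) i) (ℤ.+-assoc a (+ 1) (+ n))) ⟩
  valueOn f a (suc n) ⊕ digitValue (f (a + + suc n)) (a + + suc n) ∎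
  where
  open ≡-Reasoning
  i = (a + + 1) + + n

valueOn-suc-at : ∀ f a n {i} → a + + n ≡ i → valueOn f a (suc n) ≡ valueOn f a n ⊕ digitValue (f i) i
valueOn-suc-at f a n refl = valueOn-suc f a n

NonNeg-digitValue : ∀ b k → NonNeg (digitValue b k)
NonNeg-digitValue true k = NonNeg-φ^ k
NonNeg-digitValue false k = NonNeg-zero

NonNeg-valueOn : ∀ f a n → NonNeg (valueOn f a n)
NonNeg-valueOn f a zero = NonNeg-zero
NonNeg-valueOn f a (suc n) = subst NonNeg (sym (valueOn-suc f a n))
  (NonNeg-⊕ (NonNeg-valueOn f a n) (NonNeg-digitValue (f (a + + n)) (a + + n)))

φ^-+2-⊖ : ∀ k v → φ^ (k + + 2) ⊖ v ≡ φ^ k ⊕ (φ^ (k + + 1) ⊖ v)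
φ^-+2-⊖ k v = trans (cong (_⊖ v) (φ^-+2 k)) (rearrange (φ^ (k + + 1)) (φ^ k) v)
  where
  rearrange : ∀ x y v → (x ⊕ y) ⊖ v ≡ y ⊕ (x ⊖ v)
  rearrange ⟨ a , b ⟩ ⟨ c , d ⟩ ⟨ e , f ⟩ = cong₂ ⟨_,_⟩ (lemma a c e) (lemma b d f)
    where
    lemma : ∀ a c e → (a + c) + - e ≡ c + (a + - e)
    lemma = solve-∀

φ^-+2-⊖-φ^-+1 : ∀ k v → φ^ (k + + 2) ⊖ (v ⊕ φ^ (k + + 1)) ≡ φ^ k ⊖ v
φ^-+2-⊖-φ^-+1 k v = trans (cong (_⊖ (v ⊕ φ^ (k + + 1))) (φ^-+2 k)) (rearrange (φ^ (k + + 1)) (φ^ k) v)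
  where
  rearrange : ∀ x y v → (x ⊕ y) ⊖ (v ⊕ x) ≡ y ⊖ v
  rearrange ⟨ a , b ⟩ ⟨ c , d ⟩ ⟨ e , f ⟩ = cong₂ ⟨_,_⟩ (lemma a c e) (lemma b d f)
    where
    lemma : ∀ a c e → (a + c) + - (e + a) ≡ c + - e
    lemma = solve-∀

Positive-φ^-+1-⊖-digitValue : ∀ k b → Positive (φ^ (k + + 1) ⊖ digitValue b k)
Positive-φ^-+1-⊖-digitValue k false = subst Positive (sym (⊕-identityʳ _)) (Positive-φ^ (k + + 1))
Positive-φ^-+1-⊖-digitValue k true = subst Positive eq (Positive-φ^ (k - + 1))
  where
  k-1+1≡k : (k - + 1) + + 1 ≡ k
  k-1+1≡k = trans (ℤ.+-assoc k (- + 1) (+ 1)) (ℤ.+-identityʳ k)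
  k-1+2≡k+1 : (k - + 1) + + 2 ≡ k + + 1
  k-1+2≡k+1 = trans (ℤ.+-assoc k (- + 1) (+ 2)) refl
  eq : φ^ (k - + 1) ≡ φ^ (k + + 1) ⊖ φ^ k
  eq = begin
    φ^ (k - + 1)                                     ≡⟨ sym (⊕-identityʳ _) ⟩
    φ^ (k - + 1) ⊖ zeroφ                             ≡⟨ sym (φ^-+2-⊖-φ^-+1 (k - + 1) zeroφ) ⟩
    φ^ ((k - + 1) + + 2) ⊖ (zeroφ ⊕ φ^ ((k - + 1) + + 1)) ≡⟨ cong₂ (λ i j → φ^ i ⊖ (zeroφ ⊕ φ^ j)) k-1+2≡k+1 k-1+1≡k ⟩
    φ^ (k + + 1) ⊖ (zeroφ ⊕ φ^ k)                    ≡⟨ cong (λ x → φ^ (k + + 1) ⊖ x) (⊕-identityˡ _) ⟩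
    φ^ (k + + 1) ⊖ φ^ k                              ∎
    where open ≡-Reasoning

bound-step : ∀ f → No11 f → ∀ k v → Positive (φ^ k ⊖ v) → Positive (φ^ (k + + 1) ⊖ (v ⊕ digitValue (f k) k)) →
             Positive (φ^ (k + + 2) ⊖ ((v ⊕ digitValue (f k) k) ⊕ digitValue (f (k + + 1)) (k + + 1)))
bound-step f no11 k v pos₀ pos₁ with f (k + + 1) in e₁
... | false = subst Positive (sym (trans (cong (φ^ (k + + 2) ⊖_) (⊕-identityʳ _)) (φ^-+2-⊖ k _)))
                (NonNeg-⊕-Positive (NonNeg-φ^ k) pos₁)
... | true with f k in e₀
...   | true = ⊥-elim (no11 k (e₁ , e₀))
...   | false = subst Positive (sym (trans (cong (λ x → φ^ (k + + 2) ⊖ (x ⊕ φ^ (k + + 1))) (⊕-identityʳ v))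
                                          (φ^-+2-⊖-φ^-+1 k v))) pos₀

-- A No11 string below position k has value < φᵏ. The induction carries this bound for two consecutive
-- lengths: when the new top digit is 1 the digit below it is 0, and φᵏ⁺² = φᵏ⁺¹ + φᵏ.
valueOn-bounds : ∀ f → No11 f → ∀ a n →
  Positive (φ^ (a + + n) ⊖ valueOn f a n) × Positive (φ^ (a + + suc n) ⊖ valueOn f a (suc n))
valueOn-bounds f no11 a zero =
  subst Positive (sym (⊕-identityʳ _)) (Positive-φ^ (a + + 0)) ,
  subst Positive (cong₂ (λ i v → φ^ i ⊖ v) (cong (_+ + 1) (ℤ.+-identityʳ a)) eq)
    (Positive-φ^-+1-⊖-digitValue (a + + 0) (f (a + + 0)))
  where
  eq : digitValue (f (a + + 0)) (a + + 0) ≡ valueOn f a 1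
  eq = sym (trans (valueOn-suc f a 0) (⊕-identityˡ _))
valueOn-bounds f no11 a (suc n) with valueOn-bounds f no11 a n
... | pos₀ , pos₁ = pos₁ , subst Positive eq
  (bound-step f no11 k (valueOn f a n) pos₀ (subst Positive (cong₂ (λ i v → φ^ i ⊖ v) (+-sucʳ a n) (valueOn-suc f a n)) pos₁))
  where
  k = a + + n
  eq : φ^ (k + + 2) ⊖ ((valueOn f a n ⊕ digitValue (f k) k) ⊕ digitValue (f (k + + 1)) (k + + 1))
     ≡ φ^ (a + + suc (suc n)) ⊖ valueOn f a (suc (suc n))
  eq = cong₂ (λ i v → φ^ i ⊖ v) (trans (ℤ.+-assoc a (+ n) (+ 2)) (cong (λ m → a + + m) (ℕ.+-comm n 2)))
         (sym (trans (valueOn-suc-at f a (suc n) (+-sucʳ a n)) (cong (_⊕ digitValue (f (k + + 1)) (k + + 1)) (valueOn-suc f a n))))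

valueOn<φ^ : ∀ f → No11 f → ∀ a n → Positive (φ^ (a + + n) ⊖ valueOn f a n)
valueOn<φ^ f no11 a n = proj₁ (valueOn-bounds f no11 a n)

top-digits-agree : ∀ f g a n → No11 g → valueOn f a n ⊕ φ^ (a + + n) ≢ valueOn g a n ⊕ zeroφ
top-digits-agree f g a n no11 eq =
  NonNeg⇒¬Positive-neg (NonNeg-valueOn f a n) (subst Positive eq′ (valueOn<φ^ g no11 a n))
  where
  p⊖[w⊕p]≡-w : ∀ p w → p ⊖ (w ⊕ p) ≡ neg w
  p⊖[w⊕p]≡-w ⟨ a , b ⟩ ⟨ c , d ⟩ = cong₂ ⟨_,_⟩ (lemma a c) (lemma b d)
    where
    lemma : ∀ a c → a + - (c + a) ≡ - c
    lemma = solve-∀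
  eq′ : φ^ (a + + n) ⊖ valueOn g a n ≡ neg (valueOn f a n)
  eq′ = trans (cong (φ^ (a + + n) ⊖_) (trans (sym (⊕-identityʳ _)) (sym eq))) (p⊖[w⊕p]≡-w (φ^ (a + + n)) (valueOn f a n))

No11-valueOn-injective : ∀ n a f g → No11 f → No11 g → valueOn f a n ≡ valueOn g a n →
                         ∀ j → j < n → f (a + + j) ≡ g (a + + j)
No11-valueOn-injective (suc m) a f g no11f no11g eq j j<1+m =
  [ below , (λ j≡m → subst (λ j → f (a + + j) ≡ g (a + + j)) (sym j≡m) top-eq) ]′
    (ℕ.m≤n⇒m<n∨m≡n (ℕ.≤-pred j<1+m))
  where
  k = a + + m
  eq′ : valueOn f a m ⊕ digitValue (f k) k ≡ valueOn g a m ⊕ digitValue (g k) k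
  eq′ = trans (sym (valueOn-suc f a m)) (trans eq (valueOn-suc g a m))
  top-eq : f k ≡ g k
  top-eq with f k in fk | g k in gk
  ... | false | false = refl
  ... | true  | true  = refl
  ... | true  | false = ⊥-elim (top-digits-agree f g a m no11g
                          (subst₂ (λ b c → valueOn f a m ⊕ digitValue b k ≡ valueOn g a m ⊕ digitValue c k) fk gk eq′))
  ... | false | true  = ⊥-elim (top-digits-agree g f a m no11f
                          (sym (subst₂ (λ b c → valueOn f a m ⊕ digitValue b k ≡ valueOn g a m ⊕ digitValue c k) fk gk eq′)))
  below : j < m → f (a + + j) ≡ g (a + + j)
  below = No11-valueOn-injective m a f g no11f no11g
    (⊕-cancelʳ _ _ _ (subst (λ b → valueOn f a m ⊕ digitValue b k ≡ valueOn g a m ⊕ digitValue (g k) k) top-eq eq′)) j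

infix 4 _≼_
record _≼_ (i j : ℤ) : Set where
  constructor offset
  field
    distance : ℕ
    eq : j ≡ i + + distance

≼-refl : ∀ i → i ≼ i
≼-refl i = offset 0 (sym (ℤ.+-identityʳ i))

≼-+1 : ∀ i → i ≼ i + + 1
≼-+1 i = offset 1 refl

≼-trans : ∀ {i j k} → i ≼ j → j ≼ k → i ≼ k
≼-trans {i} (offset d₁ refl) (offset d₂ refl) = offset (d₁ ℕ.+ d₂) (ℤ.+-assoc i (+ d₁) (+ d₂))

≼-suc-contra : ∀ {i j} → j + + 1 ≼ i → i ≼ j → ⊥
≼-suc-contra {i} {j} (offset d₁ e₁) (offset d₂ refl) = ℕ.0≢1+n (trans (+ℕ-cancelˡ i eq) (ℕ.+-suc d₂ d₁))
  where
  eq : i + + 0 ≡ i + + (d₂ ℕ.+ suc d₁)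
  eq = begin
    i + + 0                        ≡⟨ ℤ.+-identityʳ i ⟩
    i                              ≡⟨ e₁ ⟩
    ((i + + d₂) + + 1) + + d₁      ≡⟨ ℤ.+-assoc (i + + d₂) (+ 1) (+ d₁) ⟩
    (i + + d₂) + + suc d₁          ≡⟨ ℤ.+-assoc i (+ d₂) (+ suc d₁) ⟩
    i + + (d₂ ℕ.+ suc d₁)          ∎
    where open ≡-Reasoning

≼-cancel-+1 : ∀ {i j} → i + + 1 ≼ j + + 1 → i ≼ j
≼-cancel-+1 {i} {j} (offset k eq) = offset k (+-cancelʳ (+ 1) j (i + + k) (trans eq (lemma i (+ k))))
  where
  lemma : ∀ i k → (i + + 1) + k ≡ (i + k) + + 1
  lemma = solve-∀

≼-antisym : ∀ {i j} → i ≼ j → j ≼ i → i ≡ j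
≼-antisym {i} (offset zero refl) _ = sym (ℤ.+-identityʳ i)
≼-antisym {i} (offset (suc d) refl) j≼i = ⊥-elim (≼-suc-contra (offset d (sym (ℤ.+-assoc i (+ 1) (+ d)))) j≼i)

SupportedIn-false : ∀ {f a n} → SupportedIn f a n → ∀ i → (∀ j → j < n → i ≢ a + + j) → f i ≡ false
SupportedIn-false {f} sf i outside with f i in fi
... | false = refl
... | true with sf i fi
...   | j , j<n , i≡a+j = ⊥-elim (outside j j<n i≡a+j)

valueOn-zero : ∀ f a n → (∀ j → j < n → f (a + + j) ≡ false) → valueOn f a n ≡ zeroφ
valueOn-zero f a zero _ = refl
valueOn-zero f a (suc n) zeros = begin
  valueOn f a (suc n)                                ≡⟨ valueOn-suc f a n ⟩
  valueOn f a n ⊕ digitValue (f (a + + n)) (a + + n) ≡⟨ cong₂ (λ v b → v ⊕ digitValue b (a + + n))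
                                                          (valueOn-zero f a n (λ j j<n → zeros j (ℕ.m<n⇒m<1+n j<n)))
                                                          (zeros n ℕ.≤-refl) ⟩
  zeroφ ⊕ zeroφ                                      ≡⟨⟩
  zeroφ                                              ∎
  where open ≡-Reasoning

valueOn-extendʳ : ∀ f a n k → (∀ j → n ≤ j → f (a + + j) ≡ false) → valueOn f a (n ℕ.+ k) ≡ valueOn f a n
valueOn-extendʳ f a n zero zeros = cong (valueOn f a) (ℕ.+-identityʳ n)
valueOn-extendʳ f a n (suc k) zeros = begin
  valueOn f a (n ℕ.+ suc k)                                        ≡⟨ cong (valueOn f a) (ℕ.+-suc n k) ⟩
  valueOn f a (suc (n ℕ.+ k))                                      ≡⟨ valueOn-suc f a (n ℕ.+ k) ⟩
  valueOn f a (n ℕ.+ k) ⊕ digitValue (f (a + + (n ℕ.+ k))) (a + + (n ℕ.+ k))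
    ≡⟨ cong (λ b → valueOn f a (n ℕ.+ k) ⊕ digitValue b (a + + (n ℕ.+ k))) (zeros (n ℕ.+ k) (ℕ.m≤m+n n k)) ⟩
  valueOn f a (n ℕ.+ k) ⊕ zeroφ                                    ≡⟨ ⊕-identityʳ _ ⟩
  valueOn f a (n ℕ.+ k)                                            ≡⟨ valueOn-extendʳ f a n k zeros ⟩
  valueOn f a n                                                    ∎
  where open ≡-Reasoning

valueOn-extendˡ : ∀ f c k n → (∀ j → j < k → f (c + + j) ≡ false) → valueOn f c (k ℕ.+ n) ≡ valueOn f (c + + k) n
valueOn-extendˡ f c zero n zeros = cong (λ a → valueOn f a n) (sym (ℤ.+-identityʳ c))
valueOn-extendˡ f c (suc k) n zeros = begin
  valueOn f c (suc (k ℕ.+ n))                   ≡⟨ valueOn-sucˡ f c (k ℕ.+ n) ⟩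
  digitValue (f c) c ⊕ valueOn f (c + + 1) (k ℕ.+ n)
    ≡⟨ cong (λ b → digitValue b c ⊕ valueOn f (c + + 1) (k ℕ.+ n)) (trans (cong f (sym (ℤ.+-identityʳ c))) (zeros 0 (ℕ.s≤s ℕ.z≤n))) ⟩
  zeroφ ⊕ valueOn f (c + + 1) (k ℕ.+ n)         ≡⟨ ⊕-identityˡ _ ⟩
  valueOn f (c + + 1) (k ℕ.+ n)                 ≡⟨ valueOn-extendˡ f (c + + 1) k n
                                                     (λ j j<k → trans (cong f (ℤ.+-assoc c (+ 1) (+ j))) (zeros (suc j) (ℕ.s≤s j<k))) ⟩
  valueOn f ((c + + 1) + + k) n                 ≡⟨ cong (λ a → valueOn f a n) (ℤ.+-assoc c (+ 1) (+ k)) ⟩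
  valueOn f (c + + suc k) n                     ∎
  where open ≡-Reasoning

valueOn-widen : ∀ f c k n k′ → SupportedIn f (c + + k) n →
                valueOn f c (k ℕ.+ (n ℕ.+ k′)) ≡ valueOn f (c + + k) n
valueOn-widen f c k n k′ sf =
  trans (valueOn-extendˡ f c k (n ℕ.+ k′) below) (valueOn-extendʳ f (c + + k) n k′ above)
  where
  below : ∀ j → j < k → f (c + + j) ≡ false
  below j j<k = SupportedIn-false {a = c + + k} {n} sf (c + + j) λ j′ _ eq →
    ℕ.<⇒≱ j<k (ℕ.≤-trans (ℕ.m≤m+n k j′) (ℕ.≤-reflexive (sym (+ℕ-cancelˡ c (trans eq (ℤ.+-assoc c (+ k) (+ j′)))))))
  above : ∀ j → n ≤ j → f ((c + + k) + + j) ≡ false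
  above j n≤j = SupportedIn-false {a = c + + k} {n} sf _ λ j′ j′<n eq → ℕ.<⇒≱ j′<n (ℕ.≤-trans n≤j (ℕ.≤-reflexive (+ℕ-cancelˡ (c + + k) eq)))

SupportedIn-widen : ∀ f c k n k′ → SupportedIn f (c + + k) n → SupportedIn f c (k ℕ.+ (n ℕ.+ k′))
SupportedIn-widen f c k n k′ sf i fi with sf i fi
... | j , j<n , refl = k ℕ.+ j , ℕ.+-monoʳ-< k (ℕ.<-≤-trans j<n (ℕ.m≤m+n n k′)) , ℤ.+-assoc c (+ k) (+ j)

record CommonWindow (a : ℤ) (n : ℕ) (b : ℤ) (m : ℕ) : Set where
  field
    start : ℤ
    before₁ after₁ before₂ after₂ : ℕ
    start₁ : a ≡ start + + before₁
    start₂ : b ≡ start + + before₂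
    same-length : before₁ ℕ.+ (n ℕ.+ after₁) ≡ before₂ ℕ.+ (m ℕ.+ after₂)

≤⇒offset : ∀ {i j} → i ℤ.≤ j → Σ ℕ λ k → j ≡ i + + k
≤⇒offset {i} {j} i≤j = ℤ.∣ j - i ∣ , trans (j≡i+[j-i] i j) (cong (λ z → i + z) (sym (ℤ.0≤i⇒+∣i∣≡i (ℤ.i≤j⇒0≤j-i i≤j))))
  where
  j≡i+[j-i] : ∀ i j → j ≡ i + (j - i)
  j≡i+[j-i] = solve-∀

commonWindow : ∀ a n b m → CommonWindow a n b m
commonWindow a n b m with ℤ.≤-total a b
... | inj₁ a≤b with ≤⇒offset a≤b
...   | k , refl = record
  { start = a ; before₁ = 0 ; after₁ = k ℕ.+ m ; before₂ = k ; after₂ = n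
  ; start₁ = sym (ℤ.+-identityʳ a) ; start₂ = refl
  ; same-length = trans (ℕ.+-comm n (k ℕ.+ m)) (ℕ.+-assoc k m n) }
commonWindow a n b m | inj₂ b≤a with ≤⇒offset b≤a
...   | k , refl = record
  { start = b ; before₁ = k ; after₁ = m ; before₂ = 0 ; after₂ = k ℕ.+ n
  ; start₁ = refl ; start₂ = sym (ℤ.+-identityʳ b)
  ; same-length = trans (sym (ℕ.+-assoc k n m)) (ℕ.+-comm (k ℕ.+ n) m) }

module _ {a n b m} (w : CommonWindow a n b m) where
  open CommonWindow w

  private
    len = before₁ ℕ.+ (n ℕ.+ after₁)

  SupportedIn-common₁ : ∀ {f} → SupportedIn f a n → SupportedIn f start len
  SupportedIn-common₁ {f} sf = SupportedIn-widen f start before₁ n after₁ (subst (λ c → SupportedIn f c n) start₁ sf)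

  SupportedIn-common₂ : ∀ {f} → SupportedIn f b m → SupportedIn f start len
  SupportedIn-common₂ {f} sf = subst (SupportedIn f start) (sym same-length)
    (SupportedIn-widen f start before₂ m after₂ (subst (λ c → SupportedIn f c m) start₂ sf))

  valueOn-common₁ : ∀ {f} → SupportedIn f a n → valueOn f start len ≡ valueOn f a n
  valueOn-common₁ {f} sf = trans (valueOn-widen f start before₁ n after₁ (subst (λ c → SupportedIn f c n) start₁ sf))
                                 (cong (λ c → valueOn f c n) (sym start₁))

  valueOn-common₂ : ∀ {f} → SupportedIn f b m → valueOn f start len ≡ valueOn f b m
  valueOn-common₂ {f} sf = trans (cong (valueOn f start) same-length)
    (trans (valueOn-widen f start before₂ m after₂ (subst (λ c → SupportedIn f c m) start₂ sf))
           (cong (λ c → valueOn f c m) (sym start₂)))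

valueOn-window-independent : ∀ f a n b m → SupportedIn f a n → SupportedIn f b m → valueOn f a n ≡ valueOn f b m
valueOn-window-independent f a n b m sfa sfb =
  trans (sym (valueOn-common₁ w sfa)) (valueOn-common₂ w sfb)
  where w = commonWindow a n b m

No11-unique : ∀ f g a n b m → No11 f → No11 g → SupportedIn f a n → SupportedIn g b m →
              valueOn f a n ≡ valueOn g b m → ∀ i → f i ≡ g i
No11-unique f g a n b m no11f no11g sf sg eq = agree-at
  where
  w = commonWindow a n b m
  open CommonWindow w
  agree : ∀ j → j < before₁ ℕ.+ (n ℕ.+ after₁) → f (start + + j) ≡ g (start + + j)
  agree = No11-valueOn-injective _ start f g no11f no11g
            (trans (valueOn-common₁ w sf) (trans eq (sym (valueOn-common₂ w sg))))
  agree-at : ∀ i → f i ≡ g i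
  agree-at i with f i in fi | g i in gi
  ... | false | false = refl
  ... | true  | true  = refl
  ... | true  | false with SupportedIn-common₁ w sf i fi
  ...   | j , j<len , refl = trans (sym fi) (trans (agree j j<len) gi)
  agree-at i | false | true with SupportedIn-common₂ w sg i gi
  ...   | j , j<len , refl = trans (sym fi) (trans (agree j j<len) gi)

SupportedBetween : Digits → ℤ → ℤ → Set
SupportedBetween f lo hi = ∀ i → f i ≡ true → lo ≼ i × i ≼ hi

lookupℕ-true⇒< : ∀ ds j → lookupℕ ds j ≡ true → j < length ds
lookupℕ-true⇒< (d ∷ ds) zero _ = ℕ.s≤s ℕ.z≤n
lookupℕ-true⇒< (d ∷ ds) (suc j) eq = ℕ.s≤s (lookupℕ-true⇒< ds j eq)

lookupℕ-applyUpTo : ∀ n g j → j < n → lookupℕ (applyUpTo g n) j ≡ g j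
lookupℕ-applyUpTo (suc n) g zero _ = refl
lookupℕ-applyUpTo (suc n) g (suc j) (ℕ.s≤s j<n) = lookupℕ-applyUpTo n (λ j → g (suc j)) j j<n

lookupℕ-applyUpTo-≥ : ∀ n g j → n ≤ j → lookupℕ (applyUpTo g n) j ≡ false
lookupℕ-applyUpTo-≥ zero g j _ = refl
lookupℕ-applyUpTo-≥ (suc n) g (suc j) (ℕ.s≤s n≤j) = lookupℕ-applyUpTo-≥ n (λ j → g (suc j)) j n≤j

applyUpTo-lookupℕ : ∀ ds → applyUpTo (lookupℕ ds) (length ds) ≡ ds
applyUpTo-lookupℕ [] = refl
applyUpTo-lookupℕ (d ∷ ds) = cong (d ∷_) (applyUpTo-lookupℕ ds)

digit-supported : ∀ r → SupportedIn (digit r) (low r) (length (digits r))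
digit-supported (rep lo ds) i di with i - lo in i-lo
... | + j = j , lookupℕ-true⇒< ds j di , trans (i≡a+[i-a] lo i) (cong (λ z → lo + z) i-lo)

valueOn-digit : ∀ r → valueOn (digit r) (low r) (length (digits r)) ≡ value r
valueOn-digit (rep lo ds) = cong (valueFrom lo)
  (trans (applyUpTo-cong (length ds) (λ j → cong (lookupℤ ds) ([a+j]-a≡j lo (+ j)))) (applyUpTo-lookupℕ ds))

fromDigits : Digits → ℤ → ℕ → Rep
fromDigits f a n = rep a (window f a n)

digit-fromDigits : ∀ f a n → SupportedIn f a n → ∀ i → digit (fromDigits f a n) i ≡ f i
digit-fromDigits f a n sf i with i - a in i-a
... | -[1+ j ] = sym (SupportedIn-false {a = a} {n} sf i λ j′ _ i≡a+j′ →
                   -[1+j]≢+j′ (trans (sym i-a) (trans (cong (_- a) i≡a+j′) ([a+j]-a≡j a (+ j′)))))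
  where
  -[1+j]≢+j′ : ∀ {j′} → -[1+ j ] ≢ + j′
  -[1+j]≢+j′ ()
... | + j with j ℕ.<? n
...   | yes j<n = trans (lookupℕ-applyUpTo n _ j j<n) (cong f (sym (trans (i≡a+[i-a] a i) (cong (λ z → a + z) i-a))))
...   | no j≮n = trans (lookupℕ-applyUpTo-≥ n _ j (ℕ.≮⇒≥ j≮n)) (sym (SupportedIn-false {a = a} {n} sf i λ j′ j′<n i≡a+j′ →
                   j≮n (subst (_< n) (ℤ.+-injective (trans (sym ([a+j]-a≡j a (+ j′))) (trans (cong (_- a) (sym i≡a+j′)) i-a))) j′<n)))

Lidx-fromDigits : ∀ f a n → Lidx (fromDigits f a (suc n)) ≡ a + + n
Lidx-fromDigits f a n = trans (cong (λ l → a + + l - + 1) (length-applyUpTo (λ j → f (a + + j)) (suc n))) (lemma a (+ n))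
  where
  lemma : ∀ a n → a + (+ 1 + n) - + 1 ≡ a + n
  lemma = solve-∀

digit-bounds : ∀ r i → digit r i ≡ true → Ridx r ≼ i × i ≼ Lidx r
digit-bounds r i di with digit-supported r i di
... | j , j<n , refl = offset j refl , offset (n ℕ.∸ suc j) eq
  where
  n = length (digits r)
  eq : low r + + n - + 1 ≡ (low r + + j) + + (n ℕ.∸ suc j)
  eq = begin
    low r + + n - + 1                          ≡⟨ cong (λ l → low r + + l - + 1) (sym (ℕ.m+[n∸m]≡n j<n)) ⟩
    low r + + (suc j ℕ.+ (n ℕ.∸ suc j)) - + 1  ≡⟨ lemma (low r) (+ j) (+ (n ℕ.∸ suc j)) ⟩
    (low r + + j) + + (n ℕ.∸ suc j)            ∎
    where
    open ≡-Reasoning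
    lemma : ∀ a b c → a + (+ 1 + b + c) - + 1 ≡ (a + b) + c
    lemma = solve-∀

Lidx-Ridx-determined : ∀ r f lo hi → Proper r → (∀ i → digit r i ≡ f i) → SupportedBetween f lo hi →
                       f lo ≡ true → f hi ≡ true → Ridx r ≡ lo × Lidx r ≡ hi
Lidx-Ridx-determined r f lo hi (dR , dL) same sf flo fhi =
  ≼-antisym (proj₁ (digit-bounds r lo (trans (same lo) flo))) (proj₁ (sf (Ridx r) (trans (sym (same (Ridx r))) dR))) ,
  ≼-antisym (proj₂ (sf (Lidx r) (trans (sym (same (Lidx r))) dL))) (proj₂ (digit-bounds r hi (trans (same hi) fhi)))

δ : ℤ → Digits
δ p i = ⌊ i ℤ.≟ p ⌋

infixl 5 _∪_
_∪_ : Digits → Digits → Digits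
(f ∪ g) i = f i ∨ g i

infixl 5 _∖_
_∖_ : Digits → ℤ → Digits
(f ∖ p) i = f i ∧ not (δ p i)

infix 4 _⊆_
_⊆_ : Digits → Digits → Set
f ⊆ g = ∀ i → f i ≡ true → g i ≡ true

Disjoint : Digits → Digits → Set
Disjoint f g = ∀ i → ¬ (f i ≡ true × g i ≡ true)

true≢false : ∀ {b} → b ≡ true → b ≢ false
true≢false refl ()

∨-true⁻ : ∀ a b → a ∨ b ≡ true → a ≡ true ⊎ b ≡ true
∨-true⁻ true b _ = inj₁ refl
∨-true⁻ false b eq = inj₂ eq

∨-trueˡ : ∀ {a} b → a ≡ true → a ∨ b ≡ true
∨-trueˡ b refl = refl

∨-trueʳ : ∀ a {b} → b ≡ true → a ∨ b ≡ true
∨-trueʳ a refl = ∨-zeroʳ a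

∨-falseˡ : ∀ {a} b → a ≡ false → a ∨ b ≡ b
∨-falseˡ b refl = refl

∨-falseʳ : ∀ a {b} → b ≡ false → a ∨ b ≡ a
∨-falseʳ a refl = ∨-identityʳ a

δ-self : ∀ p → δ p p ≡ true
δ-self p with p ℤ.≟ p
... | yes _ = refl
... | no p≢p = ⊥-elim (p≢p refl)

δ-true⁻ : ∀ {p i} → δ p i ≡ true → i ≡ p
δ-true⁻ {p} {i} eq with i ℤ.≟ p
... | yes i≡p = i≡p

δ-other : ∀ {p i} → i ≢ p → δ p i ≡ false
δ-other {p} {i} i≢p with i ℤ.≟ p
... | yes i≡p = ⊥-elim (i≢p i≡p)
... | no _ = refl

⊆-∪ˡ : ∀ f g → f ⊆ f ∪ g
⊆-∪ˡ f g i fi = ∨-trueˡ (g i) fi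

⊆-∪ʳ : ∀ f g → g ⊆ f ∪ g
⊆-∪ʳ f g i gi = ∨-trueʳ (f i) gi

∖-⊆ : ∀ f p → f ∖ p ⊆ f
∖-⊆ f p i eq with f i
... | true = refl

∖-self : ∀ f p → (f ∖ p) p ≡ false
∖-self f p = trans (cong (λ b → f p ∧ not b) (δ-self p)) (∧-zeroʳ (f p))

∖-other : ∀ f p {i} → i ≢ p → (f ∖ p) i ≡ f i
∖-other f p {i} i≢p = trans (cong (λ b → f i ∧ not b) (δ-other i≢p)) (∧-identityʳ (f i))

∪-δ-other : ∀ f p {i} → i ≢ p → (f ∪ δ p) i ≡ f i
∪-δ-other f p {i} i≢p = ∨-falseʳ (f i) (δ-other i≢p)

δ-∪-other : ∀ p f {i} → i ≢ p → (δ p ∪ f) i ≡ f i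
δ-∪-other p f i≢p = ∨-falseˡ _ (δ-other i≢p)

∖-∪-δ : ∀ f p → f p ≡ true → ∀ i → f i ≡ ((f ∖ p) ∪ δ p) i
∖-∪-δ f p fp i with i ℤ.≟ p
... | yes refl = trans fp (sym (∨-zeroʳ (f p ∧ false)))
... | no _ = sym (trans (∨-identityʳ (f i ∧ true)) (∧-identityʳ (f i)))

∖-disjoint-δ : ∀ f p → Disjoint (f ∖ p) (δ p)
∖-disjoint-δ f p i (∖i , δi) with δ-true⁻ δi
... | refl = true≢false ∖i (∖-self f p)

disjoint-δʳ : ∀ f p → f p ≡ false → Disjoint f (δ p)
disjoint-δʳ f p fp i (fi , δi) with δ-true⁻ δi
... | refl = true≢false fi fp

digitValue-∨ : ∀ x y k → ¬ (x ≡ true × y ≡ true) → digitValue (x ∨ y) k ≡ digitValue x k ⊕ digitValue y k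
digitValue-∨ true true k both = ⊥-elim (both (refl , refl))
digitValue-∨ true false k _ = sym (⊕-identityʳ (φ^ k))
digitValue-∨ false y k _ = sym (⊕-identityˡ (digitValue y k))

valueOn-∪ : ∀ f g a n → Disjoint f g → valueOn (f ∪ g) a n ≡ valueOn f a n ⊕ valueOn g a n
valueOn-∪ f g a zero _ = refl
valueOn-∪ f g a (suc n) disj = begin
  valueOn (f ∪ g) a (suc n)
    ≡⟨ valueOn-suc (f ∪ g) a n ⟩
  valueOn (f ∪ g) a n ⊕ digitValue (f k ∨ g k) k
    ≡⟨ cong₂ _⊕_ (valueOn-∪ f g a n disj) (digitValue-∨ (f k) (g k) k (disj k)) ⟩
  (valueOn f a n ⊕ valueOn g a n) ⊕ (digitValue (f k) k ⊕ digitValue (g k) k)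
    ≡⟨ interchange (valueOn f a n) (valueOn g a n) (digitValue (f k) k) (digitValue (g k) k) ⟩
  (valueOn f a n ⊕ digitValue (f k) k) ⊕ (valueOn g a n ⊕ digitValue (g k) k)
    ≡⟨ cong₂ _⊕_ (sym (valueOn-suc f a n)) (sym (valueOn-suc g a n)) ⟩
  valueOn f a (suc n) ⊕ valueOn g a (suc n) ∎
  where
  open ≡-Reasoning
  k = a + + n
  interchange : ∀ w x y z → (w ⊕ x) ⊕ (y ⊕ z) ≡ (w ⊕ y) ⊕ (x ⊕ z)
  interchange ⟨ a , b ⟩ ⟨ c , d ⟩ ⟨ e , f ⟩ ⟨ g , h ⟩ = cong₂ ⟨_,_⟩ (lemma a c e g) (lemma b d f h)
    where
    lemma : ∀ a c e g → (a + c) + (e + g) ≡ (a + e) + (c + g)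
    lemma = solve-∀

valueOn-δ : ∀ a n p → InWindow a n p → valueOn (δ p) a n ≡ φ^ p
valueOn-δ a (suc n) p (j , j<1+n , refl) with ℕ.m≤n⇒m<n∨m≡n (ℕ.≤-pred j<1+n)
... | inj₂ refl = begin
  valueOn (δ p) a (suc j)                          ≡⟨ valueOn-suc (δ p) a j ⟩
  valueOn (δ p) a j ⊕ digitValue (δ p p) p         ≡⟨ cong₂ (λ v b → v ⊕ digitValue b p)
                                                       (valueOn-zero (δ p) a j (λ i i<j → δ-other (λ eq → ℕ.<-irrefl (+ℕ-cancelˡ a eq) i<j)))
                                                       (δ-self p) ⟩
  zeroφ ⊕ φ^ p                                     ≡⟨ ⊕-identityˡ _ ⟩
  φ^ p                                             ∎
  where open ≡-Reasoning
... | inj₁ j<n = begin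
  valueOn (δ p) a (suc n)                                ≡⟨ valueOn-suc (δ p) a n ⟩
  valueOn (δ p) a n ⊕ digitValue (δ p (a + + n)) (a + + n) ≡⟨ cong₂ (λ v b → v ⊕ digitValue b (a + + n))
                                                             (valueOn-δ a n p (j , j<n , refl))
                                                             (δ-other (λ eq → ℕ.<-irrefl (+ℕ-cancelˡ a (sym eq)) j<n)) ⟩
  φ^ p ⊕ zeroφ                                           ≡⟨ ⊕-identityʳ _ ⟩
  φ^ p                                                   ∎
  where open ≡-Reasoning

valueOn-∖ : ∀ f p a n → f p ≡ true → InWindow a n p → valueOn f a n ≡ valueOn (f ∖ p) a n ⊕ φ^ p
valueOn-∖ f p a n fp p∈w = begin
  valueOn f a n                            ≡⟨ valueOn-cong a n (∖-∪-δ f p fp) ⟩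
  valueOn ((f ∖ p) ∪ δ p) a n              ≡⟨ valueOn-∪ (f ∖ p) (δ p) a n (∖-disjoint-δ f p) ⟩
  valueOn (f ∖ p) a n ⊕ valueOn (δ p) a n  ≡⟨ cong (valueOn (f ∖ p) a n ⊕_) (valueOn-δ a n p p∈w) ⟩
  valueOn (f ∖ p) a n ⊕ φ^ p               ∎
  where open ≡-Reasoning

No11-⊆ : ∀ {f g} → g ⊆ f → No11 f → No11 g
No11-⊆ g⊆f no11 i (a , b) = no11 i (g⊆f _ a , g⊆f _ b)

SupportedIn-⊆ : ∀ {f g a n} → g ⊆ f → SupportedIn f a n → SupportedIn g a n
SupportedIn-⊆ g⊆f sf i gi = sf i (g⊆f i gi)

No11-∪-δ : ∀ f p → No11 f → f (p + + 1) ≡ false → (∀ q → q + + 1 ≡ p → f q ≡ false) → No11 (f ∪ δ p)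
No11-∪-δ f p no11 above below i (fi+1 , fi) with ∨-true⁻ (f (i + + 1)) _ fi+1 | ∨-true⁻ (f i) _ fi
... | inj₁ a | inj₁ b = no11 i (a , b)
... | inj₂ a | inj₁ b = true≢false b (below i (δ-true⁻ a))
... | inj₁ a | inj₂ b with δ-true⁻ {p} {i} b
...   | refl = true≢false a above
No11-∪-δ f p no11 above below i _ | inj₂ a | inj₂ b = i+1≢i i (trans (δ-true⁻ a) (sym (δ-true⁻ b)))

record Carry (f : Digits) (p c : ℤ) (m : ℕ) : Set where
  field
    result : Digits
    no11 : No11 result
    supported : SupportedIn result c m
    adds-φ^ : valueOn result c m ≡ valueOn f c m ⊕ φ^ p
    agree-below : ∀ i → ¬ (p ≼ i) → result i ≡ f i
    half-gap : ℕ
    lands : result (p + + (2 * half-gap)) ≡ true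
    clears : ∀ u → u < 2 * half-gap → result (p + + u) ≡ false

place-digit : ∀ f p c m → No11 f → SupportedIn f c m → f p ≡ false → f (p + + 1) ≡ false →
              (∀ q → q + + 1 ≡ p → f q ≡ false) → InWindow c m p → Carry f p c m
place-digit f p c m no11 sf fp fp+1 below p∈w = record
  { result = f ∪ δ p
  ; no11 = No11-∪-δ f p no11 fp+1 below
  ; supported = supported
  ; adds-φ^ = trans (valueOn-∪ f (δ p) c m (disjoint-δʳ f p fp)) (cong (valueOn f c m ⊕_) (valueOn-δ c m p p∈w))
  ; agree-below = λ i p⋠i → trans (cong (f i ∨_) (δ-other (λ i≡p → p⋠i (subst (p ≼_) (sym i≡p) (≼-refl p)))))
                                 (∨-identityʳ (f i))
  ; half-gap = 0
  ; lands = ∨-trueʳ (f (p + + 0)) (subst (λ i → δ p i ≡ true) (sym (ℤ.+-identityʳ p)) (δ-self p))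
  ; clears = λ u ()
  }
  where
  supported : SupportedIn (f ∪ δ p) c m
  supported i fi with ∨-true⁻ (f i) (δ p i) fi
  ... | inj₁ a = sf i a
  ... | inj₂ b with δ-true⁻ {p} {i} b
  ...   | refl = p∈w

-- φᵖ⁺¹ + φᵖ = φᵖ⁺²: a digit 1 at p + 1 is moved up to p + 2.
carry-over : ∀ f p c m → f p ≡ false → f (p + + 1) ≡ true → InWindow c m (p + + 1) →
             Carry (f ∖ (p + + 1)) (p + + 2) c m → Carry f p c m
carry-over f p c m fp fp+1 p+1∈w rec = record
  { result = result
  ; no11 = no11
  ; supported = supported
  ; adds-φ^ = adds-φ^′
  ; agree-below = agree-below′
  ; half-gap = suc half-gap
  ; lands = subst (λ i → result i ≡ true) p+2+2t≡p+2[1+t] lands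
  ; clears = clears′
  }
  where
  open Carry rec
  f′ = f ∖ (p + + 1)
  p+2+2t≡p+2[1+t] : (p + + 2) + + (2 * half-gap) ≡ p + + (2 * suc half-gap)
  p+2+2t≡p+2[1+t] = trans (ℤ.+-assoc p (+ 2) (+ (2 * half-gap))) (cong (λ n → p + + n) (sym (ℕ.*-suc 2 half-gap)))
  adds-φ^′ : valueOn result c m ≡ valueOn f c m ⊕ φ^ p
  adds-φ^′ = begin
    valueOn result c m                       ≡⟨ adds-φ^ ⟩
    valueOn f′ c m ⊕ φ^ (p + + 2)            ≡⟨ cong (valueOn f′ c m ⊕_) (φ^-+2 p) ⟩
    valueOn f′ c m ⊕ (φ^ (p + + 1) ⊕ φ^ p)   ≡⟨ sym (⊕-assoc (valueOn f′ c m) (φ^ (p + + 1)) (φ^ p)) ⟩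
    (valueOn f′ c m ⊕ φ^ (p + + 1)) ⊕ φ^ p   ≡⟨ cong (_⊕ φ^ p) (sym (valueOn-∖ f (p + + 1) c m fp+1 p+1∈w)) ⟩
    valueOn f c m ⊕ φ^ p                     ∎
    where open ≡-Reasoning
  p+2⋠ : ∀ {i} → i ≼ p + + 1 → ¬ (p + + 2 ≼ i)
  p+2⋠ i≼p+1 p+2≼i = ≼-suc-contra (subst (_≼ _) (sym (ℤ.+-assoc p (+ 1) (+ 1))) p+2≼i) i≼p+1
  agree-below′ : ∀ i → ¬ (p ≼ i) → result i ≡ f i
  agree-below′ i p⋠i = trans (agree-below i (λ p+2≼i → p⋠i (≼-trans (offset 2 refl) p+2≼i)))
                             (∖-other f (p + + 1) (λ i≡p+1 → p⋠i (offset 1 i≡p+1)))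
  clears′ : ∀ u → u < 2 * suc half-gap → result (p + + u) ≡ false
  clears′ zero _ = trans (agree-below (p + + 0) (p+2⋠ (offset 1 (cong (_+ + 1) (sym (ℤ.+-identityʳ p))))))
    (trans (∖-other f (p + + 1) (λ eq → i+1≢i p (sym (trans (sym (ℤ.+-identityʳ p)) eq))))
           (trans (cong f (ℤ.+-identityʳ p)) fp))
  clears′ (suc zero) _ = trans (agree-below (p + + 1) (p+2⋠ (≼-refl _))) (∖-self f (p + + 1))
  clears′ (suc (suc u)) 2+u<2+2t = trans (cong result (sym (ℤ.+-assoc p (+ 2) (+ u))))
    (clears u (ℕ.≤-pred (ℕ.≤-pred (subst (suc (suc (suc u)) ≤_) (ℕ.*-suc 2 half-gap) 2+u<2+2t))))

-- f vanishes beyond p + fuel, so at most fuel carries occur; room guarantees the window holds them all.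
carry : ∀ fuel f p c m → No11 f → SupportedIn f c m → f p ≡ false → (∀ q → q + + 1 ≡ p → f q ≡ false) →
        (∀ x → fuel < x → f (p + + x) ≡ false) → (∀ x → x ≤ suc (2 * fuel) → InWindow c m (p + + x)) →
        Carry f p c m
carry fuel f p c m no11 sf fp below above room with f (p + + 1) in fp+1
... | false = place-digit f p c m no11 sf fp fp+1 below (subst (InWindow c m) (ℤ.+-identityʳ p) (room 0 ℕ.z≤n))
carry zero f p c m no11 sf fp below above room | true = ⊥-elim (true≢false fp+1 (above 1 (ℕ.s≤s ℕ.z≤n)))
carry (suc fuel) f p c m no11 sf fp below above room | true =
  carry-over f p c m fp fp+1 (room 1 (ℕ.s≤s ℕ.z≤n))
    (carry fuel f′ (p + + 2) c m (No11-⊆ (∖-⊆ f p+1) no11) (SupportedIn-⊆ {f} {f′} {c} {m} (∖-⊆ f p+1) sf)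
      (trans (∖-other f p+1 (λ eq → i+1≢i p+1 (trans (ℤ.+-assoc p (+ 1) (+ 1)) eq))) fp+2)
      (λ q q+1≡p+2 → subst (λ i → f′ i ≡ false) (sym (+1-cancel q+1≡p+2)) (∖-self f p+1))
      (λ x fuel<x → f′-false (trans (cong f (ℤ.+-assoc p (+ 2) (+ x))) (above (2 ℕ.+ x) (ℕ.s≤s (ℕ.m<n⇒m<1+n fuel<x)))))
      (λ x x≤ → subst (InWindow c m) (sym (ℤ.+-assoc p (+ 2) (+ x))) (room (2 ℕ.+ x) (room-bound x≤))))
  where
  p+1 = p + + 1
  f′ = f ∖ p+1
  fp+2 : f (p + + 2) ≡ false
  fp+2 with f (p + + 2) in e
  ... | false = refl
  ... | true = ⊥-elim (no11 p+1 (subst (λ i → f i ≡ true) (sym (ℤ.+-assoc p (+ 1) (+ 1))) e , fp+1))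
  +1-cancel : ∀ {q} → q + + 1 ≡ p + + 2 → q ≡ p + + 1
  +1-cancel eq = +-cancelʳ (+ 1) _ _ (trans eq (sym (ℤ.+-assoc p (+ 1) (+ 1))))
  f′-false : ∀ {i} → f i ≡ false → f′ i ≡ false
  f′-false {i} fi = trans (cong (_∧ not (δ p+1 i)) fi) refl
  room-bound : ∀ {x} → x ≤ suc (2 * fuel) → 2 ℕ.+ x ≤ suc (2 * suc fuel)
  room-bound {x} x≤ = subst (λ n → 2 ℕ.+ x ≤ suc n) (sym (ℕ.*-suc 2 fuel)) (ℕ.s≤s (ℕ.s≤s x≤))

centred-window : ∀ K i → ℤ.∣ i ∣ ≤ K → InWindow (- + K) (suc (K ℕ.+ K)) i
centred-window K (+ a) a≤K = K ℕ.+ a , ℕ.s≤s (ℕ.+-monoʳ-≤ K a≤K) , lemma (+ K) (+ a)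
  where
  lemma : ∀ k a → a ≡ - k + (k + a)
  lemma = solve-∀
centred-window K -[1+ a ] a<K = K ℕ.∸ suc a , ℕ.s≤s (ℕ.≤-trans (ℕ.m∸n≤m K (suc a)) (ℕ.m≤m+n K K)) , eq
  where
  eq : -[1+ a ] ≡ - + K + + (K ℕ.∸ suc a)
  eq = begin
    -[1+ a ]                                              ≡⟨ lemma (+ suc a) (+ (K ℕ.∸ suc a)) ⟩
    - (+ suc a + + (K ℕ.∸ suc a)) + + (K ℕ.∸ suc a)       ≡⟨ cong (λ k → - + k + + (K ℕ.∸ suc a)) (ℕ.m+[n∸m]≡n a<K) ⟩
    - + K + + (K ℕ.∸ suc a)                               ∎
    where
    open ≡-Reasoning
    lemma : ∀ s k → - s ≡ - (s + k) + k
    lemma = solve-∀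

SupportedIn⇒∣∣< : ∀ {f lo n i} → SupportedIn f lo n → f i ≡ true → ℤ.∣ i ∣ < ℤ.∣ lo ∣ ℕ.+ n
SupportedIn⇒∣∣< {lo = lo} sf fi with sf _ fi
... | j , j<n , refl = ℕ.≤-<-trans (ℤ.∣i+j∣≤∣i∣+∣j∣ lo (+ j)) (ℕ.+-monoʳ-< ℤ.∣ lo ∣ j<n)

SupportedIn-centred : ∀ {f lo n} K → SupportedIn f lo n → ℤ.∣ lo ∣ ℕ.+ n ≤ K → SupportedIn f (- + K) (suc (K ℕ.+ K))
SupportedIn-centred {f} {lo} {n} K sf le i fi = centred-window K i (ℕ.<⇒≤ (ℕ.<-≤-trans (SupportedIn⇒∣∣< {f} {lo} {n} sf fi) le))

No11Off0 : Digits → Set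
No11Off0 f = ∀ i → i ≢ + 0 → ¬ (f (i + + 1) ≡ true × f i ≡ true)

Has11At0 : Digits → Set
Has11At0 f = f (+ 1) ≡ true × f (+ 0) ≡ true

-- The shape of the Bergman expansion obtained from a special one by carrying its 11 at positions 1, 0.
CarriedShape : Digits → Set
CarriedShape f = f (+ 1) ≡ false × f (+ 0) ≡ false × f -[1+ 0 ] ≡ false ×
  Σ ℕ λ t → f (+ 2 + + (2 * t)) ≡ true × (∀ u → u < 2 * t → f (+ 2 + + u) ≡ false)

No11Off0-⊆ : ∀ {f g} → g ⊆ f → No11Off0 f → No11Off0 g
No11Off0-⊆ g⊆f valid i i≢0 (a , b) = valid i i≢0 (g⊆f _ a , g⊆f _ b)

No11Off0⇒No11 : ∀ f → No11Off0 f → ¬ Has11At0 f → No11 f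
No11Off0⇒No11 f valid ¬11 i with i ℤ.≟ + 0
... | yes refl = ¬11
... | no i≢0 = valid i i≢0

strip : Digits → Digits
strip σ = (σ ∖ + 1) ∖ + 0

strip-⊆ : ∀ σ → strip σ ⊆ σ
strip-⊆ σ i eq = ∖-⊆ σ (+ 1) i (∖-⊆ (σ ∖ + 1) (+ 0) i eq)

strip-other : ∀ σ {i} → i ≢ + 1 → i ≢ + 0 → strip σ i ≡ σ i
strip-other σ i≢1 i≢0 = trans (∖-other (σ ∖ + 1) (+ 0) i≢0) (∖-other σ (+ 1) i≢1)

strip-1 : ∀ σ → strip σ (+ 1) ≡ false
strip-1 σ = trans (∖-other (σ ∖ + 1) (+ 0) (λ ())) (∖-self σ (+ 1))

strip-0 : ∀ σ → strip σ (+ 0) ≡ false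
strip-0 σ = ∖-self (σ ∖ + 1) (+ 0)

strip-No11 : ∀ σ → No11Off0 σ → No11 (strip σ)
strip-No11 σ valid i (a , b) = by-cases (i ℤ.≟ + 0)
  where
  by-cases : Dec (i ≡ + 0) → ⊥
  by-cases (yes refl) = true≢false a (strip-1 σ)
  by-cases (no i≢0) = valid i i≢0 (strip-⊆ σ _ a , strip-⊆ σ _ b)

valueOn-strip : ∀ σ c m → Has11At0 σ → SupportedIn σ c m → valueOn σ c m ≡ (valueOn (strip σ) c m ⊕ φ^ (+ 0)) ⊕ φ^ (+ 1)
valueOn-strip σ c m (σ1 , σ0) sσ = trans (valueOn-∖ σ (+ 1) c m σ1 (sσ _ σ1))
  (cong (_⊕ φ^ (+ 1)) (valueOn-∖ (σ ∖ + 1) (+ 0) c m (trans (∖-other σ (+ 1) (λ ())) σ0) (sσ _ σ0)))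

special-unique : ∀ σ τ a n b m → No11Off0 σ → No11Off0 τ → SupportedIn σ a n → SupportedIn τ b m →
                 Has11At0 σ → Has11At0 τ → valueOn σ a n ≡ valueOn τ b m → ∀ i → σ i ≡ τ i
special-unique σ τ a n b m vσ vτ sσ sτ (σ1 , σ0) (τ1 , τ0) eq i with i ℤ.≟ + 1 | i ℤ.≟ + 0
... | yes refl | _ = trans σ1 (sym τ1)
... | no _ | yes refl = trans σ0 (sym τ0)
... | no i≢1 | no i≢0 = trans (sym (strip-other σ i≢1 i≢0))
  (trans (No11-unique (strip σ) (strip τ) a n b m (strip-No11 σ vσ) (strip-No11 τ vτ)
           (SupportedIn-⊆ {σ} {strip σ} {a} {n} (strip-⊆ σ) sσ) (SupportedIn-⊆ {τ} {strip τ} {b} {m} (strip-⊆ τ) sτ) strip-eq i)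
         (strip-other τ i≢1 i≢0))
  where
  strip-eq : valueOn (strip σ) a n ≡ valueOn (strip τ) b m
  strip-eq = ⊕-cancelʳ _ _ (φ^ (+ 0)) (⊕-cancelʳ _ _ (φ^ (+ 1))
    (trans (sym (valueOn-strip σ a n (σ1 , σ0) sσ)) (trans eq (valueOn-strip τ b m (τ1 , τ0) sτ))))

CarriedShape-cong : ∀ {f g} → (∀ i → f i ≡ g i) → CarriedShape f → CarriedShape g
CarriedShape-cong f≗g (f1 , f0 , f-1 , t , lands , clears) =
  trans (sym (f≗g _)) f1 , trans (sym (f≗g _)) f0 , trans (sym (f≗g _)) f-1 ,
  t , trans (sym (f≗g _)) lands , λ u u<2t → trans (sym (f≗g _)) (clears u u<2t)

record CarriedExpansion (v : ℤφ) : Set where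
  field
    carried : Digits
    start : ℤ
    width : ℕ
    carried-No11 : No11 carried
    carried-supported : SupportedIn carried start width
    carried-value : valueOn carried start width ≡ v
    carried-shape : CarriedShape carried

special-neighbours : ∀ σ → No11Off0 σ → Has11At0 σ → σ (+ 2) ≡ false × σ -[1+ 0 ] ≡ false
special-neighbours σ valid (σ1 , σ0) = σ2 , σ-1
  where
  σ2 : σ (+ 2) ≡ false
  σ2 with σ (+ 2) in e
  ... | false = refl
  ... | true = ⊥-elim (valid (+ 1) (λ ()) (e , σ1))
  σ-1 : σ -[1+ 0 ] ≡ false
  σ-1 with σ -[1+ 0 ] in e
  ... | false = refl
  ... | true = ⊥-elim (valid -[1+ 0 ] (λ ()) (σ0 , e))

valueOn-strip-φ² : ∀ σ c m → Has11At0 σ → SupportedIn σ c m → valueOn (strip σ) c m ⊕ φ^ (+ 2) ≡ valueOn σ c m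
valueOn-strip-φ² σ c m 11at0 sσ = begin
  valueOn (strip σ) c m ⊕ φ^ (+ 2)                    ≡⟨ cong (valueOn (strip σ) c m ⊕_) (φ^-+2 (+ 0)) ⟩
  valueOn (strip σ) c m ⊕ (φ^ (+ 1) ⊕ φ^ (+ 0))       ≡⟨ rearrange (valueOn (strip σ) c m) (φ^ (+ 1)) (φ^ (+ 0)) ⟩
  (valueOn (strip σ) c m ⊕ φ^ (+ 0)) ⊕ φ^ (+ 1)       ≡⟨ sym (valueOn-strip σ c m 11at0 sσ) ⟩
  valueOn σ c m                                       ∎
  where
  open ≡-Reasoning
  rearrange : ∀ x y z → x ⊕ (y ⊕ z) ≡ (x ⊕ z) ⊕ y
  rearrange ⟨ a , b ⟩ ⟨ c , d ⟩ ⟨ e , f ⟩ = cong₂ ⟨_,_⟩ (lemma a c e) (lemma b d f)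
    where
    lemma : ∀ a c e → a + (c + e) ≡ (a + e) + c
    lemma = solve-∀

-- The 11 at positions 1, 0 is replaced by a 1 at 2, which is then carried upwards (carry); the window
-- [−K, K] leaves room for all the carries.
carry-special : ∀ σ lo n → SupportedIn σ lo n → No11Off0 σ → Has11At0 σ → CarriedExpansion (valueOn σ lo n)
carry-special σ lo n sσ valid 11at0 = record
  { carried = result ; start = W ; width = L
  ; carried-No11 = no11 ; carried-supported = supported
  ; carried-value = trans adds-φ^ (trans (valueOn-strip-φ² σ W L 11at0 sσ′) (valueOn-window-independent σ W L lo n sσ′ sσ))
  ; carried-shape = shape }
  where
  S = strip σ
  fuel = ℤ.∣ lo ∣ ℕ.+ n
  K = fuel ℕ.+ fuel ℕ.+ 3
  W = - + K
  L = suc (K ℕ.+ K)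
  sσ′ : SupportedIn σ W L
  sσ′ = SupportedIn-centred {σ} {lo} {n} K sσ (ℕ.≤-trans (ℕ.m≤m+n fuel fuel) (ℕ.m≤m+n (fuel ℕ.+ fuel) 3))
  above : ∀ x → fuel < x → S (+ 2 + + x) ≡ false
  above x fuel<x with S (+ 2 + + x) in e
  ... | false = refl
  ... | true = ⊥-elim (ℕ.<-asym (SupportedIn⇒∣∣< {σ} {lo} {n} sσ (strip-⊆ σ _ e)) (ℕ.m<n⇒m<1+n (ℕ.m<n⇒m<1+n fuel<x)))
  room : ∀ x → x ≤ suc (2 * fuel) → InWindow W L (+ 2 + + x)
  room x x≤ = centred-window K (+ (2 ℕ.+ x)) (subst (2 ℕ.+ x ≤_) (2+[1+2f]≡f+f+3 fuel) (ℕ.s≤s (ℕ.s≤s x≤)))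
    where
    2+[1+2f]≡f+f+3 : ∀ f → 2 ℕ.+ suc (2 * f) ≡ f ℕ.+ f ℕ.+ 3
    2+[1+2f]≡f+f+3 = ℕ-Solver.solve-∀
  open Carry (carry fuel S (+ 2) W L (strip-No11 σ valid) (SupportedIn-⊆ {σ} {S} {W} {L} (strip-⊆ σ) sσ′)
               (trans (strip-other σ (λ ()) (λ ())) (proj₁ (special-neighbours σ valid 11at0)))
               (λ q q+1≡2 → subst (λ i → S i ≡ false) (sym (+-cancelʳ (+ 1) q (+ 1) q+1≡2)) (strip-1 σ))
               above room)
  shape : CarriedShape result
  shape = trans (agree-below (+ 1) λ { (offset _ ()) }) (strip-1 σ) ,
          trans (agree-below (+ 0) λ { (offset _ ()) }) (strip-0 σ) ,
          trans (agree-below -[1+ 0 ] λ { (offset _ ()) })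
                (trans (strip-other σ (λ ()) (λ ())) (proj₂ (special-neighbours σ valid 11at0))) ,
          half-gap , lands , clears

no-special : ∀ N B lo n → No11 B → SupportedIn B lo n → valueOn B lo n ≡ ℕ→ℤφ N → ¬ CarriedShape B →
             ¬ Σ Rep (IsSpecial N)
no-special N B lo n no11B sB valB ¬shape (r , _ , valr , d1 , d0 , valid) =
  ¬shape (CarriedShape-cong (No11-unique carried B start width lo n carried-No11 no11B carried-supported sB
    (trans carried-value (trans (valueOn-digit r) (trans valr (sym valB))))) carried-shape)
  where
  open CarriedExpansion (carry-special (digit r) (low r) (length (digits r)) (digit-supported r) valid (d1 , d0))

φ^-neg : ∀ m → φ^ (- + m) ≡ iter m timesφ⁻¹ oneφ
φ^-neg zero = refl
φ^-neg (suc m) = refl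

φ^-neg-rec : ∀ m → φ^ (- + m) ≡ φ^ (- + suc m) ⊕ φ^ (- + suc (suc m))
φ^-neg-rec m rewrite φ^-neg m | φ^-neg (suc m) | φ^-neg (suc (suc m)) = x≡φ⁻¹x+φ⁻²x (iter m timesφ⁻¹ oneφ)
  where
  x≡φ⁻¹x+φ⁻²x : ∀ x → x ≡ timesφ⁻¹ x ⊕ timesφ⁻¹ (timesφ⁻¹ x)
  x≡φ⁻¹x+φ⁻²x ⟨ a , b ⟩ = cong₂ ⟨_,_⟩ (lemma₁ a b) (lemma₂ a b)
    where
    lemma₁ : ∀ a b → a ≡ (b - a) + (a - (b - a))
    lemma₁ = solve-∀
    lemma₂ : ∀ a b → b ≡ a + (b - a)
    lemma₂ = solve-∀

φ^-pos-rec : ∀ m → φ^ (+ suc (suc m)) ≡ φ^ (+ suc m) ⊕ φ^ (+ m)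
φ^-pos-rec m = timesφ-timesφ (φ^ (+ m))

-- Lₙ = φⁿ + (−φ)⁻ⁿ, stated for an even n and its successor.
LucasFormulaFrom : ℕ → Set
LucasFormulaFrom k = ℕ→ℤφ (lucas k) ≡ φ^ (+ k) ⊕ φ^ (- + k) × ℕ→ℤφ (lucas (suc k)) ≡ φ^ (+ suc k) ⊖ φ^ (- + suc k)

lucas-φ^-even-step : ∀ k → ℕ→ℤφ (lucas (suc k)) ≡ φ^ (+ suc k) ⊖ φ^ (- + suc k) →
  ℕ→ℤφ (lucas k) ≡ φ^ (+ k) ⊕ φ^ (- + k) → ℕ→ℤφ (lucas (suc (suc k))) ≡ φ^ (+ suc (suc k)) ⊕ φ^ (- + suc (suc k))
lucas-φ^-even-step k L₁ L₀ = begin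
  ℕ→ℤφ (lucas (suc k)) ⊕ ℕ→ℤφ (lucas k)                   ≡⟨ cong₂ _⊕_ L₁ L₀ ⟩
  (P (suc k) ⊖ Q (suc k)) ⊕ (P k ⊕ Q k)                    ≡⟨ cong (λ q → (P (suc k) ⊖ Q (suc k)) ⊕ (P k ⊕ q)) (φ^-neg-rec k) ⟩
  (P (suc k) ⊖ Q (suc k)) ⊕ (P k ⊕ (Q (suc k) ⊕ Q (suc (suc k))))
                                                           ≡⟨ rearrange (P (suc k)) (Q (suc k)) (P k) (Q (suc (suc k))) ⟩
  (P (suc k) ⊕ P k) ⊕ Q (suc (suc k))                      ≡⟨ cong (_⊕ Q (suc (suc k))) (sym (φ^-pos-rec k)) ⟩
  P (suc (suc k)) ⊕ Q (suc (suc k))                        ∎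
  where
  open ≡-Reasoning
  P Q : ℕ → ℤφ
  P j = φ^ (+ j)
  Q j = φ^ (- + j)
  rearrange : ∀ w x y z → (w ⊖ x) ⊕ (y ⊕ (x ⊕ z)) ≡ (w ⊕ y) ⊕ z
  rearrange ⟨ a , b ⟩ ⟨ c , d ⟩ ⟨ e , f ⟩ ⟨ g , h ⟩ = cong₂ ⟨_,_⟩ (lemma a c e g) (lemma b d f h)
    where
    lemma : ∀ a c e g → (a + - c) + (e + (c + g)) ≡ (a + e) + g
    lemma = solve-∀

lucas-φ^-odd-step : ∀ k → ℕ→ℤφ (lucas (suc k)) ≡ φ^ (+ suc k) ⊕ φ^ (- + suc k) →
  ℕ→ℤφ (lucas k) ≡ φ^ (+ k) ⊖ φ^ (- + k) → ℕ→ℤφ (lucas (suc (suc k))) ≡ φ^ (+ suc (suc k)) ⊖ φ^ (- + suc (suc k))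
lucas-φ^-odd-step k L₁ L₀ = begin
  ℕ→ℤφ (lucas (suc k)) ⊕ ℕ→ℤφ (lucas k)                   ≡⟨ cong₂ _⊕_ L₁ L₀ ⟩
  (P (suc k) ⊕ Q (suc k)) ⊕ (P k ⊖ Q k)                    ≡⟨ cong (λ q → (P (suc k) ⊕ Q (suc k)) ⊕ (P k ⊖ q)) (φ^-neg-rec k) ⟩
  (P (suc k) ⊕ Q (suc k)) ⊕ (P k ⊖ (Q (suc k) ⊕ Q (suc (suc k))))
                                                           ≡⟨ rearrange (P (suc k)) (Q (suc k)) (P k) (Q (suc (suc k))) ⟩
  (P (suc k) ⊕ P k) ⊖ Q (suc (suc k))                      ≡⟨ cong (_⊖ Q (suc (suc k))) (sym (φ^-pos-rec k)) ⟩
  P (suc (suc k)) ⊖ Q (suc (suc k))                        ∎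
  where
  open ≡-Reasoning
  P Q : ℕ → ℤφ
  P j = φ^ (+ j)
  Q j = φ^ (- + j)
  rearrange : ∀ w x y z → (w ⊕ x) ⊕ (y ⊖ (x ⊕ z)) ≡ (w ⊕ y) ⊖ z
  rearrange ⟨ a , b ⟩ ⟨ c , d ⟩ ⟨ e , f ⟩ ⟨ g , h ⟩ = cong₂ ⟨_,_⟩ (lemma a c e g) (lemma b d f h)
    where
    lemma : ∀ a c e g → (a + c) + (e + - (c + g)) ≡ (a + e) + - g
    lemma = solve-∀

lucas-φ^ : ∀ m → LucasFormulaFrom (2 * m)
lucas-φ^ zero = refl , refl
lucas-φ^ (suc m) = subst LucasFormulaFrom (sym (ℕ.*-suc 2 m)) (even , lucas-φ^-odd-step (suc (2 * m)) even L₁)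
  where
  L₁ = proj₂ (lucas-φ^ m)
  even = lucas-φ^-even-step (2 * m) L₁ (proj₁ (lucas-φ^ m))

≼⇒∣∣≤ : ∀ {lo i hi} → lo ≼ i → i ≼ hi → ℤ.∣ i ∣ ≤ ℤ.∣ lo ∣ ℕ.+ ℤ.∣ hi ∣
≼⇒∣∣≤ {lo} {+ x} _ (offset k refl) = ℕ.≤-trans (ℕ.m≤m+n x k) (ℕ.m≤n+m (x ℕ.+ k) ℤ.∣ lo ∣)
≼⇒∣∣≤ {lo} { -[1+ x ]} (offset k eq) _ = ℕ.≤-trans (ℕ.m≤m+n (suc x) k) (ℕ.≤-trans (ℕ.≤-reflexive ∣lo∣≡) (ℕ.m≤m+n ℤ.∣ lo ∣ _))
  where
  -lo≡-[lo+k]+k : ∀ lo k → - lo ≡ - (lo + k) + k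
  -lo≡-[lo+k]+k = solve-∀
  ∣lo∣≡ : suc x ℕ.+ k ≡ ℤ.∣ lo ∣
  ∣lo∣≡ = trans (cong ℤ.∣_∣ (sym (trans (-lo≡-[lo+k]+k lo (+ k)) (cong (λ i → - i + + k) (sym eq))))) (ℤ.∣-i∣≡∣i∣ lo)

SupportedBetween⇒SupportedIn : ∀ {f lo hi} → SupportedBetween f lo hi →
  SupportedIn f (- + (ℤ.∣ lo ∣ ℕ.+ ℤ.∣ hi ∣)) (suc ((ℤ.∣ lo ∣ ℕ.+ ℤ.∣ hi ∣) ℕ.+ (ℤ.∣ lo ∣ ℕ.+ ℤ.∣ hi ∣)))
SupportedBetween⇒SupportedIn sf i fi = centred-window _ i (≼⇒∣∣≤ (proj₁ (sf i fi)) (proj₂ (sf i fi)))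

HasValue : Digits → ℤφ → Set
HasValue f v = ∀ c m → SupportedIn f c m → valueOn f c m ≡ v

record Expansion (f : Digits) (lo hi : ℤ) (v : ℤφ) : Set where
  field
    supported : SupportedBetween f lo hi
    valid : No11Off0 f
    has-value : HasValue f v

Expansion-∅ : ∀ lo hi → Expansion (λ _ → false) lo hi zeroφ
Expansion-∅ lo hi = record
  { supported = λ i ()
  ; valid = λ i _ ()
  ; has-value = λ c m _ → valueOn-zero (λ _ → false) c m (λ _ _ → refl)
  }

Expansion-δ : ∀ p → Expansion (δ p) p p (φ^ p)
Expansion-δ p = record
  { supported = λ i δi → subst (λ j → p ≼ j × j ≼ p) (sym (δ-true⁻ δi)) (≼-refl p , ≼-refl p)
  ; valid = λ i _ (a , b) → i+1≢i i (trans (δ-true⁻ a) (sym (δ-true⁻ b)))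
  ; has-value = λ c m sw → valueOn-δ c m p (sw p (δ-self p))
  }

SupportedBetween-∪ : ∀ {f g a b c d} → SupportedBetween f a b → SupportedBetween g c d → a ≼ c → b ≼ d →
                     SupportedBetween (f ∪ g) a d
SupportedBetween-∪ {f} {g} sf sg a≼c b≼d i fgi with ∨-true⁻ (f i) (g i) fgi
... | inj₁ fi = proj₁ (sf i fi) , ≼-trans (proj₂ (sf i fi)) b≼d
... | inj₂ gi = ≼-trans a≼c (proj₁ (sg i gi)) , proj₂ (sg i gi)

SupportedBetween-disjoint : ∀ {f g a b c d} → SupportedBetween f a b → SupportedBetween g c d → b + + 1 ≼ c →
                            Disjoint f g
SupportedBetween-disjoint sf sg gap i (fi , gi) = ≼-suc-contra (≼-trans gap (proj₁ (sg i gi))) (proj₂ (sf i fi))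

SupportedBetween-above : ∀ {f lo hi i} → SupportedBetween f lo hi → hi + + 1 ≼ i → f i ≡ false
SupportedBetween-above {f} {i = i} sf hi+1≼i with f i in fi
... | false = refl
... | true = ⊥-elim (≼-suc-contra hi+1≼i (proj₂ (sf i fi)))

HasValue-∪ : ∀ {f g v w} → Disjoint f g → HasValue f v → HasValue g w → HasValue (f ∪ g) (v ⊕ w)
HasValue-∪ {f} {g} disj hf hg c m sw =
  trans (valueOn-∪ f g c m disj)
        (cong₂ _⊕_ (hf c m (SupportedIn-⊆ {f ∪ g} {f} {c} {m} (⊆-∪ˡ f g) sw))
                   (hg c m (SupportedIn-⊆ {f ∪ g} {g} {c} {m} (⊆-∪ʳ f g) sw)))

No11Off0-∪ : ∀ {f g a b c d} → No11Off0 f → No11Off0 g → SupportedBetween f a b → SupportedBetween g c d →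
             b + + 2 ≼ c → No11Off0 (f ∪ g)
No11Off0-∪ {f} {g} {b = b} {c} vf vg sf sg gap i i≢0 (fgi+1 , fgi)
  with ∨-true⁻ (f (i + + 1)) (g (i + + 1)) fgi+1 | ∨-true⁻ (f i) (g i) fgi
... | inj₁ a | inj₁ b′ = vf i i≢0 (a , b′)
... | inj₂ a | inj₂ b′ = vg i i≢0 (a , b′)
... | inj₁ a | inj₂ b′ = ≼-suc-contra (≼-trans b+1≼c (≼-trans (proj₁ (sg i b′)) (≼-+1 i))) (proj₂ (sf _ a))
  where
  b+1≼c : b + + 1 ≼ c
  b+1≼c = ≼-trans (≼-+1 (b + + 1)) (subst (_≼ c) (sym (ℤ.+-assoc b (+ 1) (+ 1))) gap)
... | inj₂ a | inj₁ b′ = ≼-suc-contra (≼-cancel-+1 b+2≼i+1) (proj₂ (sf i b′))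
  where
  b+2≼i+1 : (b + + 1) + + 1 ≼ i + + 1
  b+2≼i+1 = subst (_≼ i + + 1) (sym (ℤ.+-assoc b (+ 1) (+ 1))) (≼-trans gap (proj₁ (sg _ a)))

⊕≡⇒≡⊖ : ∀ x y v → x ⊕ y ≡ v → x ≡ v ⊖ y
⊕≡⇒≡⊖ x y v eq = ⊕-cancelʳ x (v ⊖ y) y (trans eq (sym (v⊖y⊕y≡v v y)))
  where
  v⊖y⊕y≡v : ∀ v y → (v ⊖ y) ⊕ y ≡ v
  v⊖y⊕y≡v ⟨ a , b ⟩ ⟨ c , d ⟩ = cong₂ ⟨_,_⟩ (lemma a c) (lemma b d)
    where
    lemma : ∀ a c → (a + - c) + c ≡ a
    lemma = solve-∀

Expansion-∪ : ∀ {f g a b c d v w} → Expansion f a b v → Expansion g c d w → a ≼ c → b ≼ d → b + + 2 ≼ c →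
              Expansion (f ∪ g) a d (v ⊕ w)
Expansion-∪ {b = b} {c} ef eg a≼c b≼d gap = record
  { supported = SupportedBetween-∪ (supported ef) (supported eg) a≼c b≼d
  ; valid = No11Off0-∪ (valid ef) (valid eg) (supported ef) (supported eg) gap
  ; has-value = HasValue-∪ (SupportedBetween-disjoint (supported ef) (supported eg) b+1≼c) (has-value ef) (has-value eg)
  }
  where
  open Expansion
  b+1≼c : b + + 1 ≼ c
  b+1≼c = ≼-trans (≼-+1 (b + + 1)) (subst (_≼ c) (sym (ℤ.+-assoc b (+ 1) (+ 1))) gap)

Expansion-∖ : ∀ {g lo hi v} → Expansion g lo hi v → g lo ≡ true → Expansion (g ∖ lo) (lo + + 1) hi (v ⊖ φ^ lo)
Expansion-∖ {g} {lo} {hi} {v} eg glo = record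
  { supported = supported′
  ; valid = No11Off0-⊆ (∖-⊆ g lo) valid
  ; has-value = λ c m sw → trans (valueOn-window-independent (g ∖ lo) c m W L sw (SupportedIn-⊆ {g} {g ∖ lo} {W} {L} (∖-⊆ g lo) swg))
                                 (⊕≡⇒≡⊖ _ _ _ (trans (sym (valueOn-∖ g lo W L glo (swg lo glo))) (has-value W L swg)))
  }
  where
  open Expansion eg
  K = ℤ.∣ lo ∣ ℕ.+ ℤ.∣ hi ∣
  W = - + K
  L = suc (K ℕ.+ K)
  swg : SupportedIn g W L
  swg = SupportedBetween⇒SupportedIn supported
  supported′ : SupportedBetween (g ∖ lo) (lo + + 1) hi
  supported′ i gi with supported i (∖-⊆ g lo i gi)
  ... | offset zero eq , i≼hi = ⊥-elim (true≢false gi (trans (cong (g ∖ lo) (trans eq (ℤ.+-identityʳ lo))) (∖-self g lo)))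
  ... | offset (suc k) eq , i≼hi = offset k (trans eq (sym (ℤ.+-assoc lo (+ 1) (+ k)))) , i≼hi

Expansion-bounds : ∀ {f lo hi lo′ hi′ v} → lo ≡ lo′ → hi ≡ hi′ → Expansion f lo hi v → Expansion f lo′ hi′ v
Expansion-bounds refl refl e = e

Expansion-value : ∀ {f lo hi v w} → v ≡ w → Expansion f lo hi v → Expansion f lo hi w
Expansion-value refl e = e

+≼+ : ∀ {a b} → a ≤ b → + a ≼ + b
+≼+ {a} {b} a≤b = offset (b ℕ.∸ a) (cong +_ (sym (ℕ.m+[n∸m]≡n a≤b)))

-≼- : ∀ {a b} → a ≤ b → - + b ≼ - + a
-≼- {a} {b} a≤b = offset (b ℕ.∸ a) (begin
  - + a                                  ≡⟨ lemma (+ a) (+ (b ℕ.∸ a)) ⟩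
  - (+ a + + (b ℕ.∸ a)) + + (b ℕ.∸ a)    ≡⟨ cong (λ c → - + c + + (b ℕ.∸ a)) (ℕ.m+[n∸m]≡n a≤b) ⟩
  - + b + + (b ℕ.∸ a)                    ∎)
  where
  open ≡-Reasoning
  lemma : ∀ a k → - a ≡ - (a + k) + k
  lemma = solve-∀

-≼+ : ∀ a b → - + a ≼ + b
-≼+ a b = offset (a ℕ.+ b) (lemma (+ a) (+ b))
  where
  lemma : ∀ a b → b ≡ - a + (a + b)
  lemma = solve-∀

≼-+1-mono : ∀ {i j} → i ≼ j → i + + 1 ≼ j + + 1
≼-+1-mono {i} (offset k refl) = offset k (lemma i (+ k))
  where
  lemma : ∀ i k → (i + k) + + 1 ≡ (i + + 1) + k
  lemma = solve-∀

-[1+x]+2≡-x+1 : ∀ x → -[1+ x ] + + 2 ≡ - + x + + 1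
-[1+x]+2≡-x+1 x = lemma (+ x)
  where
  lemma : ∀ x → - (+ 1 + x) + + 2 ≡ - x + + 1
  lemma = solve-∀

-[1+x]+1≡-x : ∀ x → -[1+ x ] + + 1 ≡ - + x
-[1+x]+1≡-x zero = refl
-[1+x]+1≡-x (suc x) = refl

-[2+x]+1≡-[1+x] : ∀ x → - + (2 ℕ.+ x) + + 1 ≡ - + suc x
-[2+x]+1≡-[1+x] x = lemma (+ x)
  where
  lemma : ∀ x → - (+ 2 + x) + + 1 ≡ - (+ 1 + x)
  lemma = solve-∀

-[2+x]+2≡-x : ∀ x → - + (2 ℕ.+ x) + + 2 ≡ - + x
-[2+x]+2≡-x x = lemma (+ x)
  where
  lemma : ∀ x → - (+ 2 + x) + + 2 ≡ - x
  lemma = solve-∀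

oddBlock : ℕ → ℕ → Digits
oddBlock s zero _ = false
oddBlock s (suc t) = δ -[1+ 2 * (s ℕ.+ t) ] ∪ oddBlock s t

-- Digits 1 at −(2s+1), −(2s+3), …, −(2s+2t−1): the sum telescopes by φ⁻ᵐ = φ⁻ᵐ⁻¹ + φ⁻ᵐ⁻².
Expansion-oddBlock : ∀ s t → Expansion (oddBlock s t) (- + (2 * (s ℕ.+ t)) + + 1) -[1+ 2 * s ]
                                       (φ^ (- + (2 * s)) ⊖ φ^ (- + (2 * (s ℕ.+ t))))
Expansion-oddBlock s zero = Expansion-value (sym (trans (cong (λ t → φ^ (- + (2 * s)) ⊖ φ^ (- + (2 * t))) (ℕ.+-identityʳ s))
                                                      (⊖-self (φ^ (- + (2 * s))))))
                                            (Expansion-∅ _ _)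
Expansion-oddBlock s (suc t) =
  Expansion-bounds (cong (λ y → - + y + + 1) (sym 2[s+1+t]≡2+x)) refl
    (Expansion-value value-eq
      (Expansion-∪ (Expansion-δ -[1+ x ]) (Expansion-oddBlock s t)
        (offset 2 (sym (-[1+x]+2≡-x+1 x)))
        (-≼- (ℕ.s≤s (ℕ.*-monoʳ-≤ 2 (ℕ.m≤m+n s t))))
        (subst (_≼ - + x + + 1) (sym (-[1+x]+2≡-x+1 x)) (≼-refl _))))
  where
  x = 2 * (s ℕ.+ t)
  2[s+1+t]≡2+x : 2 * (s ℕ.+ suc t) ≡ 2 ℕ.+ x
  2[s+1+t]≡2+x = trans (cong (2 *_) (ℕ.+-suc s t)) (ℕ.*-suc 2 (s ℕ.+ t))
  Q : ℕ → ℤφ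
  Q j = φ^ (- + j)
  value-eq : Q (suc x) ⊕ (Q (2 * s) ⊖ Q x) ≡ Q (2 * s) ⊖ Q (2 * (s ℕ.+ suc t))
  value-eq = begin
    Q (suc x) ⊕ (Q (2 * s) ⊖ Q x)                         ≡⟨ cong (λ q → Q (suc x) ⊕ (Q (2 * s) ⊖ q)) (φ^-neg-rec x) ⟩
    Q (suc x) ⊕ (Q (2 * s) ⊖ (Q (suc x) ⊕ Q (2 ℕ.+ x)))   ≡⟨ rearrange (Q (suc x)) (Q (2 * s)) (Q (2 ℕ.+ x)) ⟩
    Q (2 * s) ⊖ Q (2 ℕ.+ x)                               ≡⟨ cong (λ y → Q (2 * s) ⊖ Q y) (sym 2[s+1+t]≡2+x) ⟩
    Q (2 * s) ⊖ Q (2 * (s ℕ.+ suc t))                     ∎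
    where
    open ≡-Reasoning
    rearrange : ∀ x y z → x ⊕ (y ⊖ (x ⊕ z)) ≡ y ⊖ z
    rearrange ⟨ a , b ⟩ ⟨ c , d ⟩ ⟨ e , f ⟩ = cong₂ ⟨_,_⟩ (lemma a c e) (lemma b d f)
      where
      lemma : ∀ a c e → a + (c + - (a + e)) ≡ c + - e
      lemma = solve-∀

evenExtension : ℕ → Digits → Digits
evenExtension n g = δ (- + (2 * suc n)) ∪ g ∪ δ (+ (2 * suc n))

-- The digits of g with its lowest one, at −2s, traded for 1s at −(2s+1), −(2s+3), …, −(2n+1).
oddMiddle : ℕ → ℕ → Digits → Digits
oddMiddle n s g = oddBlock s (suc n ℕ.∸ s) ∪ (g ∖ - + (2 * s))

oddExtension : ℕ → ℕ → Digits → Digits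
oddExtension n s g = δ (- + suc (suc (2 * suc n))) ∪ oddMiddle n s g ∪ δ (+ suc (2 * suc n))

Expansion-evenExtension : ∀ n k g Rk Mk → Expansion g (- + Rk) (+ Mk) (ℕ→ℤφ k) → Rk ≤ 2 * n → Mk ≤ 2 * n →
  Expansion (evenExtension n g) (- + (2 * suc n)) (+ (2 * suc n)) (ℕ→ℤφ (lucas (2 * suc n) ℕ.+ k))
Expansion-evenExtension n k g Rk Mk eg Rk≤2n Mk≤2n =
  Expansion-value value-eq
    (Expansion-∪ (Expansion-∪ (Expansion-δ (- + e)) eg (-≼- Rk≤e) (-≼+ e Mk) gap)
                 (Expansion-δ (+ e)) (-≼+ e e) (+≼+ Mk≤e) (+≼+ Mk+2≤e))
  where
  e = 2 * suc n
  e≡2+2n : e ≡ 2 ℕ.+ 2 * n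
  e≡2+2n = ℕ.*-suc 2 n
  Rk≤e : Rk ≤ e
  Rk≤e = subst (Rk ≤_) (sym e≡2+2n) (ℕ.m≤n⇒m≤o+n 2 Rk≤2n)
  Mk≤e : Mk ≤ e
  Mk≤e = subst (Mk ≤_) (sym e≡2+2n) (ℕ.m≤n⇒m≤o+n 2 Mk≤2n)
  Mk+2≤e : Mk ℕ.+ 2 ≤ e
  Mk+2≤e = subst₂ _≤_ (ℕ.+-comm 2 Mk) (sym e≡2+2n) (ℕ.+-monoʳ-≤ 2 Mk≤2n)
  gap : - + e + + 2 ≼ - + Rk
  gap = subst (_≼ - + Rk) (sym (trans (cong (λ y → - + y + + 2) e≡2+2n) (-[2+x]+2≡-x (2 * n)))) (-≼- Rk≤2n)
  value-eq : (φ^ (- + e) ⊕ ℕ→ℤφ k) ⊕ φ^ (+ e) ≡ ℕ→ℤφ (lucas e ℕ.+ k)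
  value-eq = trans (rearrange (φ^ (- + e)) (ℕ→ℤφ k) (φ^ (+ e))) (cong (_⊕ ℕ→ℤφ k) (sym (proj₁ (lucas-φ^ (suc n)))))
    where
    rearrange : ∀ x y z → (x ⊕ y) ⊕ z ≡ (z ⊕ x) ⊕ y
    rearrange ⟨ a , b ⟩ ⟨ c , d ⟩ ⟨ e , f ⟩ = cong₂ ⟨_,_⟩ (lemma a c e) (lemma b d f)
      where
      lemma : ∀ a c e → (a + c) + e ≡ (e + a) + c
      lemma = solve-∀

Expansion-oddMiddle : ∀ n k g s Mk → Expansion g (- + (2 * s)) (+ Mk) (ℕ→ℤφ k) → g (- + (2 * s)) ≡ true → s ≤ suc n →
  Expansion (oddMiddle n s g) (- + (2 * suc n) + + 1) (+ Mk)
            ((φ^ (- + (2 * s)) ⊖ φ^ (- + (2 * suc n))) ⊕ (ℕ→ℤφ k ⊖ φ^ (- + (2 * s))))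
Expansion-oddMiddle n k g s Mk eg g-2s s≤1+n =
  Expansion-∪ block (Expansion-∖ eg g-2s) (≼-+1-mono (-≼- (ℕ.*-monoʳ-≤ 2 s≤1+n))) (-≼+ (suc (2 * s)) Mk)
              (subst (_≼ - + (2 * s) + + 1) (sym (-[1+x]+2≡-x+1 (2 * s))) (≼-refl _))
  where
  t = suc n ℕ.∸ s
  block : Expansion (oddBlock s t) (- + (2 * suc n) + + 1) -[1+ 2 * s ] (φ^ (- + (2 * s)) ⊖ φ^ (- + (2 * suc n)))
  block = subst (λ y → Expansion (oddBlock s t) (- + y + + 1) -[1+ 2 * s ] (φ^ (- + (2 * s)) ⊖ φ^ (- + y)))
                (cong (2 *_) (ℕ.m+[n∸m]≡n s≤1+n)) (Expansion-oddBlock s t)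

-- With o = 2n + 3:  Lₒ + k = φ⁻⁽ᵒ⁺¹⁾ + (φ⁻²ˢ − φ⁻⁽ᵒ⁻¹⁾) + (k − φ⁻²ˢ) + φᵒ, as Lₒ = φᵒ − φ⁻ᵒ and
-- φ⁻⁽ᵒ⁻¹⁾ = φ⁻ᵒ + φ⁻⁽ᵒ⁺¹⁾.
lucas-odd-decomposition : ∀ n s k → let e = 2 * suc n ; o = suc e in
  (φ^ (- + suc o) ⊕ ((φ^ (- + (2 * s)) ⊖ φ^ (- + e)) ⊕ (ℕ→ℤφ k ⊖ φ^ (- + (2 * s))))) ⊕ φ^ (+ o)
  ≡ ℕ→ℤφ (lucas o ℕ.+ k)
lucas-odd-decomposition n s k = begin
  (Q R ⊕ ((Q (2 * s) ⊖ Q e) ⊕ (ℕ→ℤφ k ⊖ Q (2 * s)))) ⊕ φ^ (+ o)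
    ≡⟨ cong (λ q → (Q R ⊕ ((Q (2 * s) ⊖ q) ⊕ (ℕ→ℤφ k ⊖ Q (2 * s)))) ⊕ φ^ (+ o)) (φ^-neg-rec e) ⟩
  (Q R ⊕ ((Q (2 * s) ⊖ (Q o ⊕ Q R)) ⊕ (ℕ→ℤφ k ⊖ Q (2 * s)))) ⊕ φ^ (+ o)
    ≡⟨ rearrange (Q R) (Q (2 * s)) (Q o) (ℕ→ℤφ k) (φ^ (+ o)) ⟩
  (φ^ (+ o) ⊖ Q o) ⊕ ℕ→ℤφ k
    ≡⟨ cong (_⊕ ℕ→ℤφ k) (sym (proj₂ (lucas-φ^ (suc n)))) ⟩
  ℕ→ℤφ (lucas o ℕ.+ k) ∎
  where
  open ≡-Reasoning
  e = 2 * suc n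
  o = suc e
  R = suc o
  Q : ℕ → ℤφ
  Q j = φ^ (- + j)
  rearrange : ∀ x y z w p → (x ⊕ ((y ⊖ (z ⊕ x)) ⊕ (w ⊖ y))) ⊕ p ≡ (p ⊖ z) ⊕ w
  rearrange ⟨ a , a′ ⟩ ⟨ b , b′ ⟩ ⟨ c , c′ ⟩ ⟨ d , d′ ⟩ ⟨ e , e′ ⟩ =
    cong₂ ⟨_,_⟩ (lemma a b c d e) (lemma a′ b′ c′ d′ e′)
    where
    lemma : ∀ a b c d e → (a + ((b + - (c + a)) + (d + - b))) + e ≡ (e + - c) + d
    lemma = solve-∀

Expansion-oddExtension : ∀ n k g s Mk → Expansion g (- + (2 * s)) (+ Mk) (ℕ→ℤφ k) → g (- + (2 * s)) ≡ true →
  s ≤ suc n → Mk ≤ suc (2 * n) →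
  Expansion (oddExtension n s g) (- + suc (suc (2 * suc n))) (+ suc (2 * suc n)) (ℕ→ℤφ (lucas (suc (2 * suc n)) ℕ.+ k))
Expansion-oddExtension n k g s Mk eg g-2s s≤1+n Mk≤1+2n =
  Expansion-value (lucas-odd-decomposition n s k)
    (Expansion-∪ (Expansion-∪ (Expansion-δ (- + R)) (Expansion-oddMiddle n k g s Mk eg g-2s s≤1+n)
                              (≼-trans (-≼- (ℕ.≤-trans (ℕ.n≤1+n e) (ℕ.n≤1+n o))) (≼-+1 (- + e))) (-≼+ R Mk) gap)
                 (Expansion-δ (+ o)) (-≼+ R o) (+≼+ Mk≤o) (+≼+ Mk+2≤o))
  where
  e = 2 * suc n
  o = suc e
  R = suc o
  o≡3+2n : o ≡ 3 ℕ.+ 2 * n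
  o≡3+2n = cong suc (ℕ.*-suc 2 n)
  Mk≤o : Mk ≤ o
  Mk≤o = subst (Mk ≤_) (sym o≡3+2n) (ℕ.m≤n⇒m≤o+n 2 Mk≤1+2n)
  Mk+2≤o : Mk ℕ.+ 2 ≤ o
  Mk+2≤o = subst₂ _≤_ (ℕ.+-comm 2 Mk) (sym o≡3+2n) (ℕ.+-monoʳ-≤ 2 Mk≤1+2n)
  gap : - + R + + 2 ≼ - + e + + 1
  gap = subst (_≼ - + e + + 1) (sym (-[2+x]+2≡-x e)) (≼-+1 (- + e))

-- Either f is special, or f is Bergman and, by no-special, no special representation exists.
CanonicalKind : Digits → Set
CanonicalKind f = Has11At0 f ⊎ (¬ Has11At0 f × ¬ CarriedShape f)

CarriedShape-reduce : ∀ f g M → (∀ i → - + 1 ≼ i → g i ≡ true → f i ≡ true) →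
  (∀ x → f (+ x) ≡ true → g (+ x) ≡ false → M < x) → g (+ M) ≡ true → CarriedShape f → CarriedShape g
CarriedShape-reduce f g M g⊆f new-above-M gM (f1 , f0 , f-1 , t , lands , clears) =
  g-false (offset 2 refl) f1 , g-false (offset 1 refl) f0 , g-false (offset 0 refl) f-1 , t , g-lands , g-clears
  where
  g-false : ∀ {i} → - + 1 ≼ i → f i ≡ false → g i ≡ false
  g-false {i} -1≼i fi with g i in gi
  ... | false = refl
  ... | true = ⊥-elim (true≢false (g⊆f i -1≼i gi) fi)
  g-clears : ∀ u → u < 2 * t → g (+ 2 + + u) ≡ false
  g-clears u u<2t = g-false (offset (3 ℕ.+ u) refl) (clears u u<2t)
  g-lands : g (+ 2 + + (2 * t)) ≡ true
  g-lands with g (+ 2 + + (2 * t)) in gl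
  ... | true = refl
  ... | false = ⊥-elim (M-not-below M gM (new-above-M _ lands gl))
    where
    M-not-below : ∀ M → g (+ M) ≡ true → ¬ M < 2 ℕ.+ 2 * t
    M-not-below zero gM _ = true≢false gM (g-false (offset 1 refl) f0)
    M-not-below (suc zero) gM _ = true≢false gM (g-false (offset 2 refl) f1)
    M-not-below (suc (suc u)) gM (ℕ.s≤s (ℕ.s≤s u<2t)) = true≢false gM (g-clears u u<2t)

CanonicalKind-extend : ∀ {f g} M p → g (+ M) ≡ true → f (+ p) ≡ true → M < p → 1 < p →
  (∀ i → - + 1 ≼ i → i ≢ + p → f i ≡ g i) → CanonicalKind g → CanonicalKind f
CanonicalKind-extend {f} {g} M p gM fp M<p 1<p agree = extend
  where
  +p≢ : ∀ {x} → x < p → + x ≢ + p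
  +p≢ x<p eq = ℕ.<-irrefl (ℤ.+-injective eq) x<p
  f1≡g1 : f (+ 1) ≡ g (+ 1)
  f1≡g1 = agree (+ 1) (offset 2 refl) (+p≢ 1<p)
  f0≡g0 : f (+ 0) ≡ g (+ 0)
  f0≡g0 = agree (+ 0) (offset 1 refl) (+p≢ (ℕ.<-trans (ℕ.s≤s ℕ.z≤n) 1<p))
  g⊆f : ∀ i → - + 1 ≼ i → g i ≡ true → f i ≡ true
  g⊆f i -1≼i gi with i ℤ.≟ + p
  ... | yes refl = fp
  ... | no i≢p = trans (agree i -1≼i i≢p) gi
  new-above-M : ∀ x → f (+ x) ≡ true → g (+ x) ≡ false → M < x
  new-above-M x fx gx with x ℕ.≟ p
  ... | yes refl = M<p
  ... | no x≢p = ⊥-elim (true≢false (trans (sym (agree (+ x) (-≼+ 1 x) (x≢p ∘ ℤ.+-injective))) fx) gx)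
  extend : CanonicalKind g → CanonicalKind f
  extend (inj₁ (g1 , g0)) = inj₁ (trans f1≡g1 g1 , trans f0≡g0 g0)
  extend (inj₂ (¬11 , ¬shape)) =
    inj₂ ((λ (f1 , f0) → ¬11 (trans (sym f1≡g1) f1 , trans (sym f0≡g0) f0)) ,
          (λ shape → ¬shape (CarriedShape-reduce f g M g⊆f new-above-M gM shape)))

-1≼⇒≢-[2+x] : ∀ {i} x → - + 1 ≼ i → i ≢ - + (2 ℕ.+ x)
-1≼⇒≢-[2+x] x -1≼i refl = ≼-suc-contra (-≼- {1} {suc x} (ℕ.s≤s ℕ.z≤n)) -1≼i

⌈2n/2⌉≡n : ∀ n → ⌈ 2 * n /2⌉ ≡ n
⌈2n/2⌉≡n n = sym (trans (ℕ.n≡⌈n+n/2⌉ n) (cong (λ m → ⌈ n ℕ.+ m /2⌉) (sym (ℕ.+-identityʳ n))))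

⌈1+2n/2⌉≡1+n : ∀ n → ⌈ suc (2 * n) /2⌉ ≡ suc n
⌈1+2n/2⌉≡1+n n = cong suc (sym (trans (ℕ.n≡⌊n+n/2⌋ n) (cong (λ m → ⌊ n ℕ.+ m /2⌋) (sym (ℕ.+-identityʳ n)))))

record Canonical (N M : ℕ) (f : Digits) : Set where
  field
    expansion : Expansion f (- + (2 * ⌈ M /2⌉)) (+ M) (ℕ→ℤφ N)
    bottom : f (- + (2 * ⌈ M /2⌉)) ≡ true
    top : f (+ M) ≡ true
    kind : CanonicalKind f

canonical-1 : Canonical 1 0 (δ (+ 0))
canonical-1 = record
  { expansion = Expansion-δ (+ 0)
  ; bottom = refl
  ; top = refl
  ; kind = inj₂ ((λ ()) , λ ())
  }

canonical-2 : Canonical 2 1 (δ (- + 2) ∪ δ (+ 1))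
canonical-2 = record
  { expansion = Expansion-∪ (Expansion-δ (- + 2)) (Expansion-δ (+ 1)) (offset 3 refl) (offset 3 refl) (offset 1 refl)
  ; bottom = refl
  ; top = refl
  ; kind = inj₂ ((λ ()) , λ ())
  }

Expansion-11 : Expansion (δ (+ 0) ∪ δ (+ 1)) (+ 0) (+ 1) (φ^ (+ 0) ⊕ φ^ (+ 1))
Expansion-11 = record
  { supported = supported-01
  ; valid = λ i i≢0 (a , b) → i≢0 (≼-antisym (≼-cancel-+1 (proj₂ (supported-01 _ a))) (proj₁ (supported-01 i b)))
  ; has-value = HasValue-∪ (SupportedBetween-disjoint (supported (Expansion-δ _)) (supported (Expansion-δ _)) (≼-refl _))
                           (has-value (Expansion-δ _)) (has-value (Expansion-δ _))
  }
  where
  open Expansion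
  supported-01 : SupportedBetween (δ (+ 0) ∪ δ (+ 1)) (+ 0) (+ 1)
  supported-01 = SupportedBetween-∪ (supported (Expansion-δ _)) (supported (Expansion-δ _)) (offset 1 refl) (offset 1 refl)

canonical-3 : Canonical 3 1 (δ (- + 2) ∪ (δ (+ 0) ∪ δ (+ 1)))
canonical-3 = record
  { expansion = Expansion-∪ (Expansion-δ (- + 2)) Expansion-11 (offset 2 refl) (offset 3 refl) (offset 0 refl)
  ; bottom = refl
  ; top = refl
  ; kind = inj₁ (refl , refl)
  }

canonical-evenExtension : ∀ n k g Mk → Canonical k Mk g → Mk ≤ 2 * n →
                          Canonical (lucas (2 * suc n) ℕ.+ k) (2 * suc n) (evenExtension n g)
canonical-evenExtension n k g Mk c Mk≤2n = record
  { expansion = subst (λ r → Expansion f (- + (2 * r)) (+ e) (ℕ→ℤφ (lucas e ℕ.+ k))) (sym (⌈2n/2⌉≡n (suc n)))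
                  (Expansion-evenExtension n k g (2 * ⌈ Mk /2⌉) Mk expansion Rk≤2n Mk≤2n)
  ; bottom = subst (λ r → f (- + (2 * r)) ≡ true) (sym (⌈2n/2⌉≡n (suc n)))
                   (⊆-∪ˡ (δ (- + e) ∪ g) (δ (+ e)) (- + e) (⊆-∪ˡ (δ (- + e)) g (- + e) (δ-self (- + e))))
  ; top = f-top
  ; kind = CanonicalKind-extend Mk e top f-top Mk<e 1<e agree kind
  }
  where
  open Canonical c
  e = 2 * suc n
  f = evenExtension n g
  f-top : f (+ e) ≡ true
  f-top = ⊆-∪ʳ (δ (- + e) ∪ g) (δ (+ e)) (+ e) (δ-self (+ e))
  Rk≤2n : 2 * ⌈ Mk /2⌉ ≤ 2 * n
  Rk≤2n = ℕ.*-monoʳ-≤ 2 (subst (⌈ Mk /2⌉ ≤_) (⌈2n/2⌉≡n n) (ℕ.⌈n/2⌉-mono Mk≤2n))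
  Mk<e : Mk < e
  Mk<e = subst (Mk <_) (sym (ℕ.*-suc 2 n)) (ℕ.s≤s (ℕ.m≤n⇒m≤1+n Mk≤2n))
  1<e : 1 < e
  1<e = subst (1 <_) (sym (ℕ.*-suc 2 n)) (ℕ.s≤s (ℕ.s≤s ℕ.z≤n))
  agree : ∀ i → - + 1 ≼ i → i ≢ + e → f i ≡ g i
  agree i -1≼i i≢e = trans (∪-δ-other (δ (- + e) ∪ g) (+ e) i≢e)
                           (δ-∪-other (- + e) g (subst (λ y → i ≢ - + y) (sym (ℕ.*-suc 2 n)) (-1≼⇒≢-[2+x] (2 * n) -1≼i)))

oddBlock-above : ∀ s t {i} → - + (2 * s) ≼ i → oddBlock s t i ≡ false
oddBlock-above s t -2s≼i = SupportedBetween-above (Expansion.supported (Expansion-oddBlock s t))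
                                                  (subst (_≼ _) (sym (-[1+x]+1≡-x (2 * s))) -2s≼i)

oddBlock-top : ∀ s t → oddBlock s (suc t) -[1+ 2 * s ] ≡ true
oddBlock-top s zero = ∨-trueˡ false (subst (λ y → δ -[1+ 2 * y ] -[1+ 2 * s ] ≡ true) (sym (ℕ.+-identityʳ s)) (δ-self _))
oddBlock-top s (suc t) = ∨-trueʳ (δ -[1+ 2 * (s ℕ.+ suc t) ] -[1+ 2 * s ]) (oddBlock-top s t)

oddExtension-agrees : ∀ n s g {i} → s ≤ suc n → - + (2 * s) + + 1 ≼ i → i ≢ + suc (2 * suc n) →
                      oddExtension n s g i ≡ g i
oddExtension-agrees n s g {i} s≤1+n -2s+1≼i i≢o =
  trans (∪-δ-other (δ (- + R) ∪ oddMiddle n s g) (+ o) i≢o)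
    (trans (δ-∪-other (- + R) (oddMiddle n s g) i≢-R)
      (trans (∨-falseˡ _ (oddBlock-above s (suc n ℕ.∸ s) (≼-trans (≼-+1 _) -2s+1≼i)))
             (∖-other g _ (λ i≡-2s → ≼-suc-contra (subst (_≼ i) (cong (_+ + 1) (sym i≡-2s)) -2s+1≼i) (≼-refl i)))))
  where
  o = suc (2 * suc n)
  R = suc o
  i≢-R : i ≢ - + R
  i≢-R i≡-R = ≼-suc-contra (≼-trans (≼-+1-mono (-≼- 2s≤R)) -2s+1≼i) (subst (i ≼_) i≡-R (≼-refl i))
    where
    2s≤R : 2 * s ≤ R
    2s≤R = ℕ.≤-trans (ℕ.*-monoʳ-≤ 2 s≤1+n) (ℕ.≤-trans (ℕ.n≤1+n _) (ℕ.n≤1+n o))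

-- For s = 0 the odd block puts a 1 at −1 and the digit at 0 is removed: neither special nor carried shape.
CanonicalKind-oddExtension : ∀ n g s M → s ≤ suc n → g (+ M) ≡ true → M < suc (2 * suc n) →
                             CanonicalKind g → CanonicalKind (oddExtension n s g)
CanonicalKind-oddExtension n g zero M _ _ _ _ = inj₂ ((λ (_ , f0) → true≢false f0 f0-false) , λ (_ , _ , f-1 , _) → true≢false f-1-true f-1)
  where
  o = suc (2 * suc n)
  R = suc o
  f0-false : oddExtension n 0 g (+ 0) ≡ false
  f0-false = trans (∪-δ-other (δ (- + R) ∪ oddMiddle n 0 g) (+ o) {+ 0} (λ ()))
    (trans (δ-∪-other (- + R) (oddMiddle n 0 g) {+ 0} (λ ()))
      (cong₂ _∨_ (oddBlock-above 0 (suc n) (≼-refl (+ 0))) (∖-self g (+ 0))))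
  f-1-true : oddExtension n 0 g -[1+ 0 ] ≡ true
  f-1-true = ⊆-∪ˡ (δ (- + R) ∪ oddMiddle n 0 g) (δ (+ o)) -[1+ 0 ] (⊆-∪ʳ (δ (- + R)) (oddMiddle n 0 g) -[1+ 0 ]
               (⊆-∪ˡ (oddBlock 0 (suc n)) (g ∖ + 0) -[1+ 0 ] (oddBlock-top 0 n)))
CanonicalKind-oddExtension n g (suc s) M s≤1+n gM M<o =
  CanonicalKind-extend M o gM (⊆-∪ʳ (δ (- + suc o) ∪ oddMiddle n (suc s) g) (δ (+ o)) (+ o) (δ-self (+ o))) M<o 1<o
    λ i -1≼i i≢o → oddExtension-agrees n (suc s) g s≤1+n (≼-trans -2s+1≼-1 -1≼i) i≢o
  where
  o = suc (2 * suc n)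
  1<o : 1 < o
  1<o = ℕ.s≤s (subst (1 ≤_) (sym (ℕ.*-suc 2 n)) (ℕ.s≤s ℕ.z≤n))
  -2s+1≼-1 : - + (2 * suc s) + + 1 ≼ - + 1
  -2s+1≼-1 = subst (λ y → - + y + + 1 ≼ - + 1) (sym (ℕ.*-suc 2 s)) (subst (_≼ - + 1) (sym (-[2+x]+1≡-[1+x] (2 * s))) (-≼- (ℕ.s≤s ℕ.z≤n)))

canonical-oddExtension : ∀ n k g Mk → Canonical k Mk g → Mk ≤ suc (2 * n) →
  Canonical (lucas (suc (2 * suc n)) ℕ.+ k) (suc (2 * suc n)) (oddExtension n ⌈ Mk /2⌉ g)
canonical-oddExtension n k g Mk c Mk≤1+2n = record
  { expansion = subst (λ r → Expansion f (- + r) (+ o) (ℕ→ℤφ (lucas o ℕ.+ k))) R≡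
                  (Expansion-oddExtension n k g s Mk expansion bottom s≤1+n Mk≤1+2n)
  ; bottom = subst (λ r → f (- + r) ≡ true) R≡
               (⊆-∪ˡ (δ (- + R) ∪ oddMiddle n s g) (δ (+ o)) (- + R) (⊆-∪ˡ (δ (- + R)) (oddMiddle n s g) (- + R) (δ-self (- + R))))
  ; top = ⊆-∪ʳ (δ (- + R) ∪ oddMiddle n s g) (δ (+ o)) (+ o) (δ-self (+ o))
  ; kind = CanonicalKind-oddExtension n g s Mk s≤1+n top Mk<o kind
  }
  where
  open Canonical c
  o = suc (2 * suc n)
  R = suc o
  s = ⌈ Mk /2⌉
  f = oddExtension n s g
  s≤1+n : s ≤ suc n
  s≤1+n = subst (s ≤_) (⌈1+2n/2⌉≡1+n n) (ℕ.⌈n/2⌉-mono Mk≤1+2n)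
  R≡ : R ≡ 2 * ⌈ o /2⌉
  R≡ = sym (trans (cong (2 *_) (⌈1+2n/2⌉≡1+n (suc n))) (ℕ.*-suc 2 (suc n)))
  Mk<o : Mk < o
  Mk<o = ℕ.s≤s (subst (Mk ≤_) (sym (ℕ.*-suc 2 n)) (ℕ.m≤n⇒m≤o+n 1 Mk≤1+2n))

lucas-positive : ∀ n → 1 ≤ lucas n
lucas-positive zero = ℕ.s≤s ℕ.z≤n
lucas-positive (suc zero) = ℕ.s≤s ℕ.z≤n
lucas-positive (suc (suc n)) = ℕ.≤-trans (lucas-positive (suc n)) (ℕ.m≤m+n _ _)

lucas-suc-< : ∀ n → lucas (suc n) < lucas (suc (suc n))
lucas-suc-< n = subst (_≤ lucas (suc n) ℕ.+ lucas n) (ℕ.+-comm (lucas (suc n)) 1)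
                      (ℕ.+-monoʳ-≤ (lucas (suc n)) (lucas-positive n))

lucas-suc-mono-≤ : ∀ {a b} → a ≤ b → lucas (suc a) ≤ lucas (suc b)
lucas-suc-mono-≤ {b = zero} ℕ.z≤n = ℕ.≤-refl
lucas-suc-mono-≤ {b = suc b} a≤1+b with ℕ.m≤n⇒m<n∨m≡n a≤1+b
... | inj₂ refl = ℕ.≤-refl
... | inj₁ a<1+b = ℕ.≤-trans (lucas-suc-mono-≤ (ℕ.≤-pred a<1+b)) (ℕ.<⇒≤ (lucas-suc-< b))

InΓ-disjoint : ∀ a b N → InΓ a N → InΓ b N → a ≡ b
InΓ-disjoint zero zero N _ _ = refl
InΓ-disjoint zero (suc b) N refl (L<1 , _) = ⊥-elim (ℕ.<⇒≱ L<1 (lucas-positive (suc b)))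
InΓ-disjoint (suc a) zero N (L<1 , _) refl = ⊥-elim (ℕ.<⇒≱ L<1 (lucas-positive (suc a)))
InΓ-disjoint (suc a) (suc b) N (La<N , N≤La+1) (Lb<N , N≤Lb+1) with ℕ.<-cmp a b
... | tri≈ _ a≡b _ = cong suc a≡b
... | tri< a<b _ _ = ⊥-elim (ℕ.<⇒≱ Lb<N (ℕ.≤-trans N≤La+1 (lucas-suc-mono-≤ a<b)))
... | tri> _ _ b<a = ⊥-elim (ℕ.<⇒≱ La<N (ℕ.≤-trans N≤Lb+1 (lucas-suc-mono-≤ b<a)))

InΓ-level-≤ : ∀ M k j → InΓ M k → k ≤ lucas (suc j) → M ≤ j
InΓ-level-≤ zero k j _ _ = ℕ.z≤n
InΓ-level-≤ (suc M) k j (LM<k , _) k≤Lj+1 with suc M ℕ.≤? j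
... | yes M<j = M<j
... | no M≮j = ⊥-elim (ℕ.<⇒≱ (ℕ.<-≤-trans LM<k k≤Lj+1) (lucas-suc-mono-≤ (ℕ.≤-pred (ℕ.≰⇒> M≮j))))

n<lucas : ∀ n → n < lucas (suc n)
n<lucas zero = ℕ.s≤s ℕ.z≤n
n<lucas (suc n) = ℕ.<-≤-trans (ℕ.s≤s (n<lucas n)) (lucas-suc-< n)

InΓ-cover-below : ∀ N j → 2 ≤ N → N ≤ lucas (suc (suc j)) → Σ ℕ λ m → 1 ≤ m × InΓ m N
InΓ-cover-below N zero 2≤N N≤3 = 1 , ℕ.s≤s ℕ.z≤n , 2≤N , N≤3
InΓ-cover-below N (suc j) 2≤N N≤L with N ℕ.≤? lucas (suc (suc j))
... | yes N≤L′ = InΓ-cover-below N j 2≤N N≤L′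
... | no N≰L′ = suc (suc j) , ℕ.s≤s ℕ.z≤n , ℕ.≰⇒> N≰L′ , N≤L

InΓ-cover : ∀ N → 2 ≤ N → Σ ℕ λ m → 1 ≤ m × InΓ m N
InΓ-cover N 2≤N = InΓ-cover-below N N 2≤N (ℕ.<⇒≤ (ℕ.<-trans (ℕ.n<1+n N) (n<lucas (suc N))))

CanonicalUpTo : ℕ → ℕ → Set
CanonicalUpTo n N = Σ ℕ λ M → InΓ M N × M ≤ suc (2 * n) × Σ Digits (Canonical N M)

lucas-split-even : ∀ n → lucas (suc (2 * suc n)) ≡ lucas (2 * suc n) ℕ.+ lucas (suc (2 * n))
lucas-split-even n = cong (λ m → lucas (2 * suc n) ℕ.+ lucas m) (ℕ.+-suc n (n ℕ.+ 0))

lucas-split-odd : ∀ n → lucas (2 * suc (suc n)) ≡ lucas (suc (2 * suc n)) ℕ.+ lucas (2 * suc n)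
lucas-split-odd n = cong lucas (ℕ.*-suc 2 (suc n))

lucas-2n+1≤lucas-2n+2 : ∀ n → lucas (suc (2 * n)) ≤ lucas (2 * suc n)
lucas-2n+1≤lucas-2n+2 n = subst (λ m → lucas (suc (2 * n)) ≤ lucas m) (sym (ℕ.*-suc 2 n)) (ℕ.<⇒≤ (lucas-suc-< (2 * n)))

CanonicalUpTo-even : ∀ n N → lucas (2 * suc n) < N → N ℕ.∸ lucas (2 * suc n) ≤ lucas (suc (2 * n)) →
                 N ≤ lucas (suc (2 * suc n)) → CanonicalUpTo n (N ℕ.∸ lucas (2 * suc n)) → CanonicalUpTo (suc n) N
CanonicalUpTo-even n N Le<N k≤L2n+1 N≤Le+1 (Mk , Γk , _ , g , ck) =
  2 * suc n , (Le<N , N≤Le+1) , ℕ.n≤1+n _ , f ,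
  subst (λ N → Canonical N (2 * suc n) f) (ℕ.m+[n∸m]≡n (ℕ.<⇒≤ Le<N))
        (canonical-evenExtension n _ g Mk ck (InΓ-level-≤ Mk _ (2 * n) Γk k≤L2n+1))
  where
  f = evenExtension n g

CanonicalUpTo-odd : ∀ n N → lucas (suc (2 * suc n)) < N → N ≤ lucas (2 * suc (suc n)) →
                CanonicalUpTo n (N ℕ.∸ lucas (suc (2 * suc n))) → CanonicalUpTo (suc n) N
CanonicalUpTo-odd n N Lo<N N≤Lo+1 (Mk , Γk , Mk≤1+2n , g , ck) =
  suc (2 * suc n) , (Lo<N , subst (N ≤_) (cong lucas (ℕ.*-suc 2 (suc n))) N≤Lo+1) , ℕ.≤-refl , f ,
  subst (λ N → Canonical N (suc (2 * suc n)) f) (ℕ.m+[n∸m]≡n (ℕ.<⇒≤ Lo<N)) (canonical-oddExtension n _ g Mk ck Mk≤1+2n)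
  where
  f = oddExtension n ⌈ Mk /2⌉ g

canonical-up-to : ∀ n N → 1 ≤ N → N ≤ lucas (2 * suc n) → CanonicalUpTo n N
canonical-up-to zero 1 _ _ = 0 , refl , ℕ.z≤n , _ , canonical-1
canonical-up-to zero 2 _ _ = 1 , (ℕ.≤-refl , ℕ.n≤1+n 2) , ℕ.≤-refl , _ , canonical-2
canonical-up-to zero 3 _ _ = 1 , (ℕ.n≤1+n 2 , ℕ.≤-refl) , ℕ.≤-refl , _ , canonical-3
canonical-up-to zero (suc (suc (suc (suc N)))) _ (ℕ.s≤s (ℕ.s≤s (ℕ.s≤s ())))
canonical-up-to (suc n) N 1≤N N≤L with N ℕ.≤? lucas (2 * suc n) | N ℕ.≤? lucas (suc (2 * suc n))
... | yes N≤Le | _ with canonical-up-to n N 1≤N N≤Le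
...   | M , ΓM , M≤1+2n , f , c = M , ΓM , ℕ.≤-trans M≤1+2n (ℕ.s≤s (ℕ.*-monoʳ-≤ 2 (ℕ.n≤1+n n))) , f , c
canonical-up-to (suc n) N 1≤N N≤L | no N≰Le | yes N≤Lo =
  CanonicalUpTo-even n N (ℕ.≰⇒> N≰Le) k≤L2n+1 N≤Lo
    (canonical-up-to n _ (ℕ.m<n⇒0<n∸m (ℕ.≰⇒> N≰Le)) (ℕ.≤-trans k≤L2n+1 (lucas-2n+1≤lucas-2n+2 n)))
  where
  k≤L2n+1 : N ℕ.∸ lucas (2 * suc n) ≤ lucas (suc (2 * n))
  k≤L2n+1 = ℕ.m≤n+o⇒m∸n≤o N _ (subst (N ≤_) (lucas-split-even n) N≤Lo)
canonical-up-to (suc n) N 1≤N N≤L | no _ | no N≰Lo =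
  CanonicalUpTo-odd n N (ℕ.≰⇒> N≰Lo) N≤L
    (canonical-up-to n _ (ℕ.m<n⇒0<n∸m (ℕ.≰⇒> N≰Lo)) (ℕ.m≤n+o⇒m∸n≤o N _ (subst (N ≤_) (lucas-split-odd n) N≤L)))

SupportedBetween⇒window : ∀ {f} lo d → SupportedBetween f lo (lo + + d) → SupportedIn f lo (suc d)
SupportedBetween⇒window {f} lo d sf i fi with sf i fi
... | offset j refl , offset k eq = j , ℕ.s≤s (subst (j ≤_) (sym d≡j+k) (ℕ.m≤m+n j k)) , refl
  where
  d≡j+k : d ≡ j ℕ.+ k
  d≡j+k = +ℕ-cancelˡ lo (trans eq (ℤ.+-assoc lo (+ j) (+ k)))

IsCanonical⇒Proper : ∀ {N r} → IsCanonical N r → Proper r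
IsCanonical⇒Proper (inj₁ (p , _)) = p
IsCanonical⇒Proper (inj₂ (_ , p , _)) = p

module CanonicalRep {N M f} (c : Canonical N M f) where
  open Canonical c
  open Expansion expansion

  R = 2 * ⌈ M /2⌉
  lo = - + R

  lo+[R+M]≡M : lo + + (R ℕ.+ M) ≡ + M
  lo+[R+M]≡M = lemma (+ R) (+ M)
    where
    lemma : ∀ r m → - r + (r + m) ≡ m
    lemma = solve-∀

  window-supported : SupportedIn f lo (suc (R ℕ.+ M))
  window-supported = SupportedBetween⇒window lo (R ℕ.+ M) (subst (SupportedBetween f lo) (sym lo+[R+M]≡M) supported)

  rep₀ : Rep
  rep₀ = fromDigits f lo (suc (R ℕ.+ M))

  digit-rep₀ : ∀ i → digit rep₀ i ≡ f i
  digit-rep₀ = digit-fromDigits f lo (suc (R ℕ.+ M)) window-supported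

  value-rep₀ : value rep₀ ≡ ℕ→ℤφ N
  value-rep₀ = has-value lo (suc (R ℕ.+ M)) window-supported

  proper-rep₀ : Proper rep₀
  proper-rep₀ = trans (digit-rep₀ lo) bottom ,
    trans (cong (digit rep₀) (trans (Lidx-fromDigits f lo (R ℕ.+ M)) lo+[R+M]≡M)) (trans (digit-rep₀ (+ M)) top)

  digit-rep₀-11 : ∀ i → digit rep₀ (i + + 1) ≡ true × digit rep₀ i ≡ true → f (i + + 1) ≡ true × f i ≡ true
  digit-rep₀-11 i (a , b) = trans (sym (digit-rep₀ _)) a , trans (sym (digit-rep₀ i)) b

  special-rep₀ : Has11At0 f → IsSpecial N rep₀
  special-rep₀ (f1 , f0) = proper-rep₀ , value-rep₀ , trans (digit-rep₀ _) f1 , trans (digit-rep₀ _) f0 ,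
                           λ i i≢0 → valid i i≢0 ∘ digit-rep₀-11 i

  no-special-rep : ¬ Has11At0 f → ¬ CarriedShape f → ¬ Σ Rep (IsSpecial N)
  no-special-rep ¬11 ¬shape = no-special N f lo (suc (R ℕ.+ M)) (No11Off0⇒No11 f valid ¬11) window-supported value-rep₀ ¬shape

  canonical-rep₀ : IsCanonical N rep₀
  canonical-rep₀ with kind
  ... | inj₁ 11at0 = inj₁ (special-rep₀ 11at0)
  ... | inj₂ (¬11 , ¬shape) = inj₂ (no-special-rep ¬11 ¬shape ,
          proper-rep₀ , value-rep₀ , λ i → No11Off0⇒No11 f valid ¬11 i ∘ digit-rep₀-11 i)

  canonical-digits : ∀ r → IsCanonical N r → ∀ i → digit r i ≡ f i
  canonical-digits r canonical with canonical | kind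
  ... | inj₁ (_ , valr , d1 , d0 , validr) | inj₁ 11at0 =
        special-unique (digit r) f (low r) (length (digits r)) lo (suc (R ℕ.+ M)) validr valid (digit-supported r)
          window-supported (d1 , d0) 11at0 (trans (valueOn-digit r) (trans valr (sym value-rep₀)))
  ... | inj₁ special | inj₂ (¬11 , ¬shape) = ⊥-elim (no-special-rep ¬11 ¬shape (r , special))
  ... | inj₂ (¬special , _) | inj₁ 11at0 = ⊥-elim (¬special (rep₀ , special-rep₀ 11at0))
  ... | inj₂ (_ , _ , valr , no11r) | inj₂ (¬11 , _) =
        No11-unique (digit r) f (low r) (length (digits r)) lo (suc (R ℕ.+ M)) no11r
          (No11Off0⇒No11 f valid ¬11) (digit-supported r) window-supported
          (trans (valueOn-digit r) (trans valr (sym value-rep₀)))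

  canonical-Lidx-Ridx : ∀ r → IsCanonical N r → Lidx r ≡ + M × Ridx r ≡ lo
  canonical-Lidx-Ridx r canonical =
    swap (Lidx-Ridx-determined r f lo (+ M) (IsCanonical⇒Proper canonical) (canonical-digits r canonical) supported bottom top)

canonical-in-Γ : ∀ m N → 1 ≤ m → InΓ m N →
  Σ Rep (IsCanonical N) × (∀ r → IsCanonical N r → Lidx r ≡ + m × Ridx r ≡ - + (2 * ⌈ m /2⌉))
canonical-in-Γ (suc m) N _ Γm@(Lm<N , N≤Lm+1)
  with canonical-up-to (suc m) N (ℕ.≤-trans (ℕ.s≤s ℕ.z≤n) Lm<N)
         (ℕ.≤-trans N≤Lm+1 (lucas-suc-mono-≤ (ℕ.s≤s (ℕ.m≤m+n m _))))
... | M , ΓM , _ , f , c with InΓ-disjoint M (suc m) N ΓM Γm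
...   | refl = (rep₀ , canonical-rep₀) , canonical-Lidx-Ridx
  where open CanonicalRep c

InΓ-iff : ∀ {N m k} {P : Set} → InΓ m N → (P → k ≡ m) → (k ≡ m → P) → P ⇔ InΓ k N
InΓ-iff {N} Γm P⇒k≡m k≡m⇒P =
  mk⇔ (λ p → subst (λ j → InΓ j N) (sym (P⇒k≡m p)) Γm) (λ Γk → k≡m⇒P (InΓ-disjoint _ _ N Γk Γm))

Lidx-Ridx-in-Γ : ∀ m N → 1 ≤ m → InΓ m N →
  Σ Rep (IsCanonical N) ×
  ((r : Rep) → IsCanonical N r →
    ((n : ℕ) → m ≡ 2 * n → (Lidx r ≡ + (2 * n)) × (Ridx r ≡ - + (2 * n))) ×
    ((n : ℕ) → m ≡ suc (2 * n) → (Lidx r ≡ + suc (2 * n)) × (Ridx r ≡ - + suc (suc (2 * n)))))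
Lidx-Ridx-in-Γ m N 1≤m Γm = proj₁ (canonical-in-Γ m N 1≤m Γm) , λ r c →
  (λ { n refl → proj₁ (LR r c) , trans (proj₂ (LR r c)) (cong (λ x → - + (2 * x)) (⌈2n/2⌉≡n n)) }) ,
  (λ { n refl → proj₁ (LR r c) , trans (proj₂ (LR r c))
                  (cong (λ x → - + x) (trans (cong (2 *_) (⌈1+2n/2⌉≡1+n n)) (ℕ.*-suc 2 n))) })
  where
  LR = proj₂ (canonical-in-Γ m N 1≤m Γm)

Γ-by-Lidx-Ridx : ∀ N → 2 ≤ N → (r : Rep) → IsCanonical N r → (n : ℕ) →
  (((Lidx r ≡ + (2 * n)) × (Ridx r ≡ - + (2 * n))) ⇔ InΓ (2 * n) N) ×
  (((Lidx r ≡ + suc (2 * n)) × (Ridx r ≡ - + suc (suc (2 * n)))) ⇔ InΓ (suc (2 * n)) N)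
Γ-by-Lidx-Ridx N 2≤N r c n with InΓ-cover N 2≤N
... | m , 1≤m , Γm =
  InΓ-iff Γm (level ∘ proj₁) (λ 2n≡m → proj₁ (LR-by-parity r c) n (sym 2n≡m)) ,
  InΓ-iff Γm (level ∘ proj₁) (λ 2n+1≡m → proj₂ (LR-by-parity r c) n (sym 2n+1≡m))
  where
  LR-by-parity = proj₂ (Lidx-Ridx-in-Γ m N 1≤m Γm)
  level : ∀ {k} → Lidx r ≡ + k → k ≡ m
  level L≡k = ℤ.+-injective (trans (sym L≡k) (proj₁ (proj₂ (canonical-in-Γ m N 1≤m Γm) r c)))

proposition6 : ((m N : ℕ) → 1 ≤ m → InΓ m N →
      Σ Rep (IsCanonical N) ×
      ((r : Rep) → IsCanonical N r →
        ((n : ℕ) → m ≡ 2 * n → (Lidx r ≡ + (2 * n)) × (Ridx r ≡ - + (2 * n))) ×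
        ((n : ℕ) → m ≡ suc (2 * n) → (Lidx r ≡ + suc (2 * n)) × (Ridx r ≡ - + suc (suc (2 * n))))))
    ×
    ((N : ℕ) → 2 ≤ N → (r : Rep) → IsCanonical N r → (n : ℕ) →
      (((Lidx r ≡ + (2 * n)) × (Ridx r ≡ - + (2 * n))) ⇔ InΓ (2 * n) N) ×
      (((Lidx r ≡ + suc (2 * n)) × (Ridx r ≡ - + suc (suc (2 * n)))) ⇔ InΓ (suc (2 * n)) N))
proposition6 = Lidx-Ridx-in-Γ , Γ-by-Lidx-Ridx
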